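{- Let $G$ be a connected graph of order $n$. Then $pd_s(G)=n-1$ if and only if $G\cong P_3$, $G\cong C_4$, $G\cong K_n-e$, or $G\cong K_1+\bigcup_{i}K_{n_i}$ where the union has more than one component, $n_i\ge 1$ for every $i$ and $\sum_i n_i=n-1$.
   Context: Graphs are finite, simple, connected; $d_G$ is shortest-path distance, $d_G(x,W)=\min\{d_G(x,w):w\in W\}$. A set $W$ strongly resolves different vertices $x,y\notin W$ if $d_G(x,W)=d_G(x,y)+d_G(y,W)$ or $d_G(y,W)=d_G(y,x)+d_G(x,W)$. A vertex partition $\Pi$ is a strong resolving partition if every two different vertices in the same set of $\Pi$ are strongly resolved by some set of $\Pi$; $pd_s(G)$ is the minimum cardinality of such a partition. $K_n-e$ is the complete graph minus one edge; $K_1+H$ denotes the join of a single vertex with $H$ (the vertex is joined to all vertices of $H$); $\bigcup_i K_{n_i}$ is the disjoint union of complete graphs. -}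

module Defs where

open import Data.Nat using (ℕ; zero; suc; _+_; _≤_; _<_; _⊓_; _≡ᵇ_)
open import Data.Bool using (Bool; true; false; _∧_; _∨_; not; if_then_else_)
open import Data.Fin using (Fin; toℕ) renaming (zero to fzero; suc to fsuc)
import Data.Fin as F
open import Data.List using (List; allFin; foldr)
open import Data.Bool.ListAction using (any)
open import Data.Product using (Σ; ∃; ∃-syntax; _×_; _,_)
open import Data.Sum using (_⊎_)
open import Relation.Nullary using (¬_)
open import Relation.Nullary.Decidable using (⌊_⌋)
open import Relation.Binary.PropositionalEquality using (_≡_; _≢_)
open import Function.Bundles using (_↔_; Inverse)
open import Function.Definitions using (Surjective)

Graph : ℕ → Set
Graph n = Fin n → Fin n → Bool

IsSimple : ∀ {n} → Graph n → Set
IsSimple {n} G = (∀ x y → G x y ≡ G y x) × (∀ x → G x x ≡ false)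

data Walk {n} (G : Graph n) : Fin n → Fin n → ℕ → Set where
  here : ∀ {x} → Walk G x x 0
  step : ∀ {x y z k} → G x y ≡ true → Walk G y z k → Walk G x z (suc k)

Connected : ∀ {n} → Graph n → Set
Connected {n} G = ∀ (x y : Fin n) → ∃[ k ] Walk G x y k

-- reach G k x y = true iff there is a walk of length ≤ k from x to y.
reach : ∀ {n} → Graph n → ℕ → Fin n → Fin n → Bool
reach {n} G zero x y = ⌊ x F.≟ y ⌋
reach {n} G (suc k) x y = reach G k x y ∨ any (λ z → G x z ∧ reach G k z y) (allFin n)

-- least k ≥ start (searching with the given fuel) with reach G k x y.
minReach : ∀ {n} → Graph n → Fin n → Fin n → ℕ → ℕ → ℕ
minReach G x y zero k = k
minReach G x y (suc f) k = if reach G k x y then k else minReach G x y f (suc k)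

-- Shortest-path distance d_G(x,y) (correct for connected graphs, where it is ≤ n-1).
dist : ∀ {n} → Graph n → Fin n → Fin n → ℕ
dist {n} G x y = minReach G x y n 0

-- d_G(x, W_j) where W_j = { v | p v ≡ j } is the j-th part of the partition p
-- (minimum over the part; parts are nonempty, so the initial value n is never the result
--  in a connected graph).
setDist : ∀ {n k} → Graph n → (Fin n → Fin k) → Fin n → Fin k → ℕ
setDist {n} G p x j =
  foldr (λ v acc → if ⌊ p v F.≟ j ⌋ then dist G x v ⊓ acc else acc) n (allFin n)

StronglyResolves : ∀ {n k} → Graph n → (Fin n → Fin k) → Fin k → Fin n → Fin n → Set
StronglyResolves G p j x y =
  (setDist G p x j ≡ dist G x y + setDist G p y j)
  ⊎ (setDist G p y j ≡ dist G y x + setDist G p x j)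

-- A partition of V(G) into exactly k nonempty parts (p assigns each vertex its part)
-- that is a strong resolving partition.
IsStrongResolvingPartition : ∀ {n k} → Graph n → (Fin n → Fin k) → Set
IsStrongResolvingPartition {n} {k} G p =
  Surjective _≡_ _≡_ p
  × (∀ x y → x ≢ y → p x ≡ p y →
       ∃[ j ] (¬ (p x ≡ j) × ¬ (p y ≡ j) × StronglyResolves G p j x y))

HasSRP : ∀ {n} → Graph n → ℕ → Set
HasSRP {n} G k = Σ (Fin n → Fin k) (IsStrongResolvingPartition G)

PdsEq : ∀ {n} → Graph n → ℕ → Set
PdsEq G m = HasSRP G m × (∀ k → k < m → ¬ HasSRP G k)

_≅_ : ∀ {n m} → Graph n → Graph m → Set
_≅_ {n} {m} G H = Σ (Fin n ↔ Fin m) λ f →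
  ∀ x y → H (Inverse.to f x) (Inverse.to f y) ≡ G x y

P3 : Graph 3
P3 x y = (suc (toℕ x) ≡ᵇ toℕ y) ∨ (suc (toℕ y) ≡ᵇ toℕ x)

C4 : Graph 4
C4 x y = (suc (toℕ x) ≡ᵇ toℕ y) ∨ (suc (toℕ y) ≡ᵇ toℕ x)
       ∨ ((toℕ x ≡ᵇ 0) ∧ (toℕ y ≡ᵇ 3)) ∨ ((toℕ x ≡ᵇ 3) ∧ (toℕ y ≡ᵇ 0))

KminusE : ∀ m → Graph (suc (suc m))
KminusE m x y = not (toℕ x ≡ᵇ toℕ y)
  ∧ not (((toℕ x ≡ᵇ 0) ∧ (toℕ y ≡ᵇ 1)) ∨ ((toℕ x ≡ᵇ 1) ∧ (toℕ y ≡ᵇ 0)))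

-- K_1 + ⋃_i K_{n_i}: vertex fzero is the apex; vertex fsuc a lies in the clique c a,
-- i.e. the cliques are the fibres of c (with n_i = |c⁻¹(i)|, Σ n_i = m).
K1Join : ∀ {m r} → (Fin m → Fin r) → Graph (suc m)
K1Join c fzero fzero = false
K1Join c fzero (fsuc b) = true
K1Join c (fsuc a) fzero = true
K1Join c (fsuc a) (fsuc b) = not ⌊ a F.≟ b ⌋ ∧ ⌊ c a F.≟ c b ⌋

module Submission where

-- Strong resolving partitions are built in one way only: merge a few
-- pairs {s,t}, each resolved by a vertex w kept as a singleton class, which works as soon as
-- t lies on a geodesic from s to w (`Between s t w`).  Merging one pair gives n - 1 classes,
-- merging two pairs or one triple gives n - 2.  Lower bounds use diameter ≤ 2: there a class
-- W can only resolve s,t if st is an edge, s has no neighbour in W and t has one (`Orient`);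
-- when this forces all vertices but one into distinct classes, at least n - 1 classes are needed.
-- Backward direction: each of the four families has diameter ≤ 2, an induced P₃ and the
-- lower-bound property.  Forward direction: pd_s = n - 1 excludes partitions with n - 2 classes.
-- Diameter ≥ 3 would yield a mergeable triple, completeness is excluded by pigeonhole, and the
-- number of universal vertices (none / at least two / exactly one) then forces C₄, Kₙ - e or
-- K₁ + ⋃ K_{nᵢ} respectively; these graphs are recognised by explicit isomorphisms.

open import Defs
open import Data.Nat using (ℕ; zero; suc; _+_; _<_; _≤_; _∸_; _⊓_; _≡ᵇ_; z≤n; s≤s)
open import Data.Nat.Properties
  using (<-irrefl; ≤-refl; ≤-reflexive; ≤-trans; ≤-antisym; ≤-<-trans; <-≤-trans; m≤m+n;
         +-identityʳ; +-suc; ≤∧≢⇒<; <-cmp; ⊓-sel; ⊓-glb; m⊓n≤m; m⊓n≤n; ≡ᵇ⇒≡; ≡⇒≡ᵇ)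
import Data.Bool
open import Data.Bool using (Bool; T; true; false; _∧_; _∨_; not; if_then_else_)
open import Data.Bool.Properties using (¬-not; T-≡)
open import Data.Bool.ListAction using (any)
open import Data.Fin using (Fin; toℕ; punchIn; punchOut) renaming (zero to fzero; suc to fsuc)
import Data.Fin as F
import Data.Fin.Properties as FP
import Data.Fin.Permutation.Components as PC
open import Data.Fin.Permutation using (transpose; _∘ₚ_)
open import Data.List using (List; []; _∷_; allFin; foldr)
open import Data.List.Membership.Propositional using (_∈_; lose)
open import Data.List.Membership.Propositional.Properties using (∈-allFin)
open import Data.List.Relation.Unary.Any using (here; there; satisfied)
open import Data.List.Relation.Unary.Any.Properties using (any⁺; any⁻)
open import Data.Product using (Σ; ∃; ∃-syntax; _×_; _,_; proj₁; proj₂)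
open import Data.Sum using (_⊎_; inj₁; inj₂)
import Data.Sum as Sum
open import Data.Empty using (⊥; ⊥-elim)
open import Function using (_∘_)
open import Function.Bundles using (Inverse; Equivalence; _↔_; _⇔_; mk↔ₛ′; mk⇔)
open import Function.Definitions using (Surjective)
import Function.Construct.Composition as Comp
open import Relation.Binary using (tri<; tri≈; tri>)
open import Relation.Binary.PropositionalEquality
  using (_≡_; _≢_; refl; sym; trans; cong; cong₂; subst; subst₂; ≢-sym)
open import Relation.Nullary using (¬_; Dec; yes; no; ¬?)
open import Relation.Nullary.Decidable using (⌊_⌋; from-yes; _×-dec_; _⊎-dec_; _→-dec_)

∨-true : ∀ {a b} → a ∨ b ≡ true → a ≡ true ⊎ b ≡ true
∨-true {true} _ = inj₁ refl
∨-true {false} e = inj₂ e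

∨-introˡ : ∀ {a} b → a ≡ true → a ∨ b ≡ true
∨-introˡ b refl = refl

∨-introʳ : ∀ a {b} → b ≡ true → a ∨ b ≡ true
∨-introʳ true _ = refl
∨-introʳ false e = e

∧-true : ∀ {a b} → a ∧ b ≡ true → a ≡ true × b ≡ true
∧-true {true} {true} _ = refl , refl

∧-intro : ∀ {a b} → a ≡ true → b ≡ true → a ∧ b ≡ true
∧-intro refl refl = refl

bool-ext : ∀ {a b : Bool} → (a ≡ true → b ≡ true) → (b ≡ true → a ≡ true) → a ≡ b
bool-ext {true} {true} _ _ = refl
bool-ext {true} {false} f _ = sym (f refl)
bool-ext {false} {true} _ g = g refl
bool-ext {false} {false} _ _ = refl

t≢f : true ≢ false
t≢f ()

≢true⇒false : ∀ {b} → b ≢ true → b ≡ false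
≢true⇒false = ¬-not

≢false⇒true : ∀ {b} → b ≢ false → b ≡ true
≢false⇒true = ¬-not

separates : ∀ {n} {x y : Fin n} (h : Fin n → Bool) → h x ≡ true → h y ≡ false → x ≢ y
separates h hx hy e = t≢f (trans (sym hx) (trans (cong h e) hy))

≟-true⇒≡ : ∀ {n} (x y : Fin n) → ⌊ x F.≟ y ⌋ ≡ true → x ≡ y
≟-true⇒≡ x y e with x F.≟ y
... | yes p = p

≡⇒≟-true : ∀ {n} (x y : Fin n) → x ≡ y → ⌊ x F.≟ y ⌋ ≡ true
≡⇒≟-true x y e with x F.≟ y
... | yes _ = refl
... | no q = ⊥-elim (q e)

≢⇒≟-false : ∀ {n} (x y : Fin n) → x ≢ y → ⌊ x F.≟ y ⌋ ≡ false
≢⇒≟-false x y ne with x F.≟ y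
... | yes p = ⊥-elim (ne p)
... | no _ = refl

any-allFin⇒ : ∀ {n} (P : Fin n → Bool) → any P (allFin n) ≡ true → ∃ λ z → P z ≡ true
any-allFin⇒ {n} P e with satisfied (any⁻ P (allFin n) (Equivalence.from T-≡ e))
... | z , t = z , Equivalence.to T-≡ t

any-allFin⇐ : ∀ {n} (P : Fin n → Bool) z → P z ≡ true → any P (allFin n) ≡ true
any-allFin⇐ P z e = Equivalence.to T-≡ (any⁺ P (lose (∈-allFin z) (Equivalence.from T-≡ e)))

two-distinct : ∀ {n} (x y : Fin n) → x ≢ y → 2 ≤ n
two-distinct {suc zero} fzero fzero ne = ⊥-elim (ne refl)
two-distinct {suc (suc n)} _ _ _ = s≤s (s≤s z≤n)

three-distinct : ∀ {n} (x y z : Fin n) → x ≢ y → x ≢ z → y ≢ z → 3 ≤ n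
three-distinct {suc (suc (suc n))} _ _ _ _ _ _ = s≤s (s≤s (s≤s z≤n))
three-distinct {suc zero} fzero fzero _ xy _ _ = ⊥-elim (xy refl)
three-distinct {suc (suc zero)} fzero fzero _ xy _ _ = ⊥-elim (xy refl)
three-distinct {suc (suc zero)} (fsuc fzero) (fsuc fzero) _ xy _ _ = ⊥-elim (xy refl)
three-distinct {suc (suc zero)} fzero (fsuc fzero) fzero _ xz _ = ⊥-elim (xz refl)
three-distinct {suc (suc zero)} fzero (fsuc fzero) (fsuc fzero) _ _ yz = ⊥-elim (yz refl)
three-distinct {suc (suc zero)} (fsuc fzero) fzero fzero _ _ yz = ⊥-elim (yz refl)
three-distinct {suc (suc zero)} (fsuc fzero) fzero (fsuc fzero) _ xz _ = ⊥-elim (xz refl)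

one≤ : ∀ {n} (x : Fin n) → 1 ≤ n
one≤ {suc n} _ = s≤s z≤n

module Reach {n} (G : Graph n) where

  reach-suc→ : ∀ k x y → reach G (suc k) x y ≡ true →
    reach G k x y ≡ true ⊎ ∃ λ z → G x z ≡ true × reach G k z y ≡ true
  reach-suc→ k x y e with ∨-true {reach G k x y} e
  ... | inj₁ r = inj₁ r
  ... | inj₂ r with any-allFin⇒ (λ z → G x z ∧ reach G k z y) r
  ... | z , ez = inj₂ (z , ∧-true ez)

  reach-mono : ∀ k x y → reach G k x y ≡ true → reach G (suc k) x y ≡ true
  reach-mono k x y e = ∨-introˡ _ e

  reach-step : ∀ k x z y → G x z ≡ true → reach G k z y ≡ true → reach G (suc k) x y ≡ true
  reach-step k x z y e1 e2 =
    ∨-introʳ (reach G k x y) (any-allFin⇐ (λ z → G x z ∧ reach G k z y) z (∧-intro e1 e2))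

  reach0→ : ∀ x y → reach G 0 x y ≡ true → x ≡ y
  reach0→ = ≟-true⇒≡

  reach0← : ∀ x → reach G 0 x x ≡ true
  reach0← x = ≡⇒≟-true x x refl

  reach-refl : ∀ k x → reach G k x x ≡ true
  reach-refl zero x = reach0← x
  reach-refl (suc k) x = reach-mono k x x (reach-refl k x)

  reach-snoc : ∀ k x v y → reach G k x v ≡ true → G v y ≡ true → reach G (suc k) x y ≡ true
  reach-snoc zero x v y e g with reach0→ x v e
  ... | refl = reach-step 0 x y y g (reach0← y)
  reach-snoc (suc k) x v y e g with reach-suc→ k x v e
  ... | inj₁ r = reach-mono (suc k) x y (reach-snoc k x v y r g)
  ... | inj₂ (z , gz , r) = reach-step (suc k) x z y gz (reach-snoc k z v y r g)

  reach1→ : ∀ x y → reach G 1 x y ≡ true → x ≡ y ⊎ G x y ≡ true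
  reach1→ x y e with reach-suc→ 0 x y e
  ... | inj₁ r = inj₁ (reach0→ x y r)
  ... | inj₂ (z , gz , r) with reach0→ z y r
  ... | refl = inj₂ gz

  reach1← : ∀ x y → G x y ≡ true → reach G 1 x y ≡ true
  reach1← x y g = reach-step 0 x y y g (reach0← y)

  reach2→ : ∀ x y → reach G 2 x y ≡ true →
    x ≡ y ⊎ G x y ≡ true ⊎ ∃ λ z → G x z ≡ true × G z y ≡ true
  reach2→ x y e with reach-suc→ 1 x y e
  ... | inj₁ r with reach1→ x y r
  ... | inj₁ q = inj₁ q
  ... | inj₂ q = inj₂ (inj₁ q)
  reach2→ x y e | inj₂ (z , gz , r) with reach1→ z y r
  ... | inj₁ refl = inj₂ (inj₁ gz)
  ... | inj₂ q = inj₂ (inj₂ (z , gz , q))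

  reach2← : ∀ x z y → G x z ≡ true → G z y ≡ true → reach G 2 x y ≡ true
  reach2← x z y g1 g2 = reach-step 1 x z y g1 (reach1← z y g2)

  minReach-le : ∀ x y f s → minReach G x y f s ≤ s + f
  minReach-le x y zero s = ≤-reflexive (sym (+-identityʳ s))
  minReach-le x y (suc f) s with reach G s x y
  ... | true = m≤m+n s (suc f)
  ... | false = subst (minReach G x y f (suc s) ≤_) (sym (+-suc s f)) (minReach-le x y f (suc s))

  minReach-min : ∀ x y f s k → s ≤ k → reach G k x y ≡ true → minReach G x y f s ≤ k
  minReach-min x y zero s k s≤k r = s≤k
  minReach-min x y (suc f) s k s≤k r with reach G s x y in eq
  ... | true = s≤k
  ... | false with s Data.Nat.≟ k
  ... | yes refl = ⊥-elim (t≢f (trans (sym r) eq))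
  ... | no s≢k = minReach-min x y f (suc s) k (≤∧≢⇒< s≤k s≢k) r

  minReach-hit : ∀ x y f s → minReach G x y f s < s + f → reach G (minReach G x y f s) x y ≡ true
  minReach-hit x y zero s lt = ⊥-elim (<-irrefl (sym (+-identityʳ s)) lt)
  minReach-hit x y (suc f) s lt with reach G s x y in eq
  ... | true = eq
  ... | false = minReach-hit x y f (suc s) (subst (minReach G x y f (suc s) <_) (+-suc s f) lt)

module Distance {n} (G : Graph n) (simp : IsSimple G) where
  open Reach G

  adj≢ : ∀ {x y} → G x y ≡ true → x ≢ y
  adj≢ {x} g refl = t≢f (trans (sym g) (proj₂ simp x))

  adj-sym : ∀ {x y} → G x y ≡ true → G y x ≡ true
  adj-sym {x} {y} g = trans (proj₁ simp y x) g

  nadj-sym : ∀ {x y} → G x y ≡ false → G y x ≡ false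
  nadj-sym {x} {y} g = trans (proj₁ simp y x) g

  reach-sym : ∀ k x y → reach G k x y ≡ true → reach G k y x ≡ true
  reach-sym zero x y e with reach0→ x y e
  ... | refl = e
  reach-sym (suc k) x y e with reach-suc→ k x y e
  ... | inj₁ r = reach-mono k y x (reach-sym k x y r)
  ... | inj₂ (z , g , r) = reach-snoc k y z x (reach-sym k z y r) (adj-sym g)

  dist-le-n : ∀ x y → dist G x y ≤ n
  dist-le-n x y = minReach-le x y n 0

  dist-min : ∀ k x y → reach G k x y ≡ true → dist G x y ≤ k
  dist-min k x y r = minReach-min x y n 0 k z≤n r

  dist-hit : ∀ x y → dist G x y < n → reach G (dist G x y) x y ≡ true
  dist-hit x y lt = minReach-hit x y n 0 lt

  dist-exact : ∀ k x y → k ≤ n → reach G k x y ≡ true →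
    (∀ j → j < k → reach G j x y ≡ false) → dist G x y ≡ k
  dist-exact k x y k≤n r below with <-cmp (dist G x y) k
  ... | tri≈ _ e _ = e
  ... | tri> _ _ gt = ⊥-elim (<-irrefl refl (≤-<-trans (dist-min k x y r) gt))
  ... | tri< lt _ _ =
        ⊥-elim (t≢f (trans (sym (dist-hit x y (<-≤-trans lt k≤n))) (below _ lt)))

  dist-pos : ∀ x y → x ≢ y → 1 ≤ dist G x y
  dist-pos x y ne with dist G x y in eq
  ... | suc _ = s≤s z≤n
  ... | zero = ⊥-elim (ne (reach0→ x y (subst (λ d → reach G d x y ≡ true) eq
                 (dist-hit x y (subst (_< n) (sym eq) (one≤ x))))))

  dist1 : ∀ x y → G x y ≡ true → dist G x y ≡ 1
  dist1 x y g = dist-exact 1 x y (≤-trans (s≤s z≤n) (two-distinct x y (adj≢ g))) (reach1← x y g)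
    λ { zero _ → ≢true⇒false (λ r → adj≢ g (reach0→ x y r)) ; (suc j) (s≤s ()) }

  dist2 : ∀ x z y → x ≢ y → G x y ≡ false → G x z ≡ true → G z y ≡ true → dist G x y ≡ 2
  dist2 x z y ne nadj g1 g2 = dist-exact 2 x y (two-distinct x y ne) (reach2← x z y g1 g2)
    λ { zero _ → ≢true⇒false (λ r → ne (reach0→ x y r))
      ; (suc zero) _ → ≢true⇒false (λ r → notWithin1 (reach1→ x y r))
      ; (suc (suc j)) (s≤s (s≤s ())) }
    where notWithin1 : x ≡ y ⊎ G x y ≡ true → ⊥
          notWithin1 (inj₁ e) = ne e
          notWithin1 (inj₂ e) = t≢f (trans (sym e) nadj)

  dist1→adj : ∀ x y → x ≢ y → dist G x y ≡ 1 → G x y ≡ true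
  dist1→adj x y ne e with reach1→ x y (subst (λ d → reach G d x y ≡ true) e
                            (dist-hit x y (subst (_< n) (sym e) (two-distinct x y ne))))
  ... | inj₁ q = ⊥-elim (ne q)
  ... | inj₂ g = g

  module SetDistance {k} (p : Fin n → Fin k) (x : Fin n) (j : Fin k) where
    fold : List (Fin n) → ℕ → ℕ
    fold L b = foldr (λ v acc → if ⌊ p v F.≟ j ⌋ then dist G x v ⊓ acc else acc) b L

    fold-le : ∀ L b v → v ∈ L → p v ≡ j → fold L b ≤ dist G x v
    fold-le (u ∷ L) b v (here refl) pv with p v F.≟ j
    ... | yes _ = m⊓n≤m _ _
    ... | no q = ⊥-elim (q pv)
    fold-le (u ∷ L) b v (there m) pv with ⌊ p u F.≟ j ⌋
    ... | true = ≤-trans (m⊓n≤n _ _) (fold-le L b v m pv)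
    ... | false = fold-le L b v m pv

    fold-attain : ∀ L b → fold L b ≡ b ⊎ ∃ λ v → p v ≡ j × fold L b ≡ dist G x v
    fold-attain [] b = inj₁ refl
    fold-attain (u ∷ L) b with p u F.≟ j
    ... | no _ = fold-attain L b
    ... | yes pu with ⊓-sel (dist G x u) (fold L b)
    ... | inj₁ e = inj₂ (u , pu , e)
    ... | inj₂ e rewrite e = fold-attain L b

    fold-ge : ∀ L b c → (∀ v → p v ≡ j → c ≤ dist G x v) → c ≤ b → c ≤ fold L b
    fold-ge [] b c h hb = hb
    fold-ge (u ∷ L) b c h hb with p u F.≟ j
    ... | no _ = fold-ge L b c h hb
    ... | yes pu = ⊓-glb (h u pu) (fold-ge L b c h hb)

  sd-le : ∀ {k} (p : Fin n → Fin k) x j v → p v ≡ j → setDist G p x j ≤ dist G x v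
  sd-le p x j v pv = SetDistance.fold-le p x j (allFin n) n v (∈-allFin v) pv

  sd-attain : ∀ {k} (p : Fin n → Fin k) x j →
    setDist G p x j ≡ n ⊎ ∃ λ v → p v ≡ j × setDist G p x j ≡ dist G x v
  sd-attain p x j = SetDistance.fold-attain p x j (allFin n) n

  sd-ge : ∀ {k} (p : Fin n → Fin k) x j c →
    (∀ v → p v ≡ j → c ≤ dist G x v) → c ≤ n → c ≤ setDist G p x j
  sd-ge p x j c h hb = SetDistance.fold-ge p x j (allFin n) n c h hb

  sd-single : ∀ {k} (p : Fin n → Fin k) x w → (∀ v → p v ≡ p w → v ≡ w) →
    setDist G p x (p w) ≡ dist G x w
  sd-single p x w sing with sd-attain p x (p w)
  ... | inj₂ (v , pv , e) with sing v pv
  ... | refl = e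
  sd-single p x w sing | inj₁ e =
    ≤-antisym (sd-le p x (p w) w refl) (subst (dist G x w ≤_) (sym e) (dist-le-n x w))

Pair : ∀ {n} → Fin n → Fin n → Fin n → Fin n → Set
Pair s t a b = (s ≡ a × t ≡ b) ⊎ (s ≡ b × t ≡ a)

-- `merge a b` is a surjection Fin (suc m) → Fin m whose only nontrivial fibre is {a, b}:
-- it sends b to the image of a and renumbers the other vertices.
merge : ∀ {m} (a b : Fin (suc m)) → a ≢ b → Fin (suc m) → Fin m
merge a b ne v with v F.≟ b
... | yes _ = punchOut {i = b} {j = a} (ne ∘ sym)
... | no v≢b = punchOut {i = b} {j = v} (v≢b ∘ sym)

merge-eq : ∀ {m} (a b : Fin (suc m)) (ne : a ≢ b) s t →
  merge a b ne s ≡ merge a b ne t → s ≡ t ⊎ Pair s t a b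
merge-eq a b ne s t e with s F.≟ b | t F.≟ b
... | yes refl | yes refl = inj₁ refl
... | yes refl | no q = inj₂ (inj₂ (refl , sym (FP.punchOut-injective (ne ∘ sym) (q ∘ sym) e)))
... | no q | yes refl = inj₂ (inj₁ (FP.punchOut-injective (q ∘ sym) (ne ∘ sym) e , refl))
... | no q | no r = inj₁ (FP.punchOut-injective (q ∘ sym) (r ∘ sym) e)

merge-fixes : ∀ {m} (a b : Fin (suc m)) (ne : a ≢ b) {s t} →
  merge a b ne s ≡ merge a b ne t → t ≢ a → t ≢ b → s ≡ t
merge-fixes a b ne {s} {t} e ta tb with merge-eq a b ne s t e
... | inj₁ q = q
... | inj₂ (inj₁ (_ , q)) = ⊥-elim (tb q)
... | inj₂ (inj₂ (_ , q)) = ⊥-elim (ta q)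

merge-surj : ∀ {m} (a b : Fin (suc m)) (ne : a ≢ b) → Surjective _≡_ _≡_ (merge a b ne)
merge-surj a b ne y = punchIn b y , λ { refl → merge-punchIn }
  where
  merge-punchIn : merge a b ne (punchIn b y) ≡ y
  merge-punchIn with punchIn b y F.≟ b
  ... | yes e = ⊥-elim (FP.punchInᵢ≢i b y e)
  ... | no _ = trans (FP.punchOut-cong b refl) (FP.punchOut-punchIn b)

injectiveAway⇒≤ : ∀ {n k} (p : Fin n → Fin k) (a : Fin n) →
  (∀ x y → x ≢ a → y ≢ a → x ≢ y → p x ≢ p y) → n ∸ 1 ≤ k
injectiveAway⇒≤ {suc n} p a h = FP.injective⇒≤ {f = p ∘ punchIn a} injective
  where
  injective : ∀ {i j} → p (punchIn a i) ≡ p (punchIn a j) → i ≡ j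
  injective {i} {j} e with i F.≟ j
  ... | yes q = q
  ... | no q = ⊥-elim (h _ _ (FP.punchInᵢ≢i a i) (FP.punchInᵢ≢i a j)
                          (q ∘ FP.punchIn-injective a i j) e)

module Resolving {n} (G : Graph n) (simp : IsSimple G) where
  open Distance G simp

  -- t lies on a geodesic from s to w; then {w} strongly resolves s and t.
  Between : Fin n → Fin n → Fin n → Set
  Between s t w = dist G s w ≡ dist G s t + dist G t w

  Singleton : ∀ {k} → (Fin n → Fin k) → Fin n → Set
  Singleton p w = ∀ v → p v ≡ p w → v ≡ w

  SingletonResolver : ∀ {k} → (Fin n → Fin k) → Fin n → Fin n → Set
  SingletonResolver p s t =
    ∃ λ w → Singleton p w × w ≢ s × w ≢ t × (Between s t w ⊎ Between t s w)

  singletonResolved⇒SRP : ∀ {k} (p : Fin n → Fin k) → Surjective _≡_ _≡_ p →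
    (∀ s t → s ≢ t → p s ≡ p t → SingletonResolver p s t) → HasSRP G k
  singletonResolved⇒SRP p surj resolver = p , surj , λ s t ne pe → resolves s t (resolver s t ne pe)
    where
    resolves : ∀ s t → SingletonResolver p s t →
      ∃ λ j → ¬ (p s ≡ j) × ¬ (p t ≡ j) × StronglyResolves G p j s t
    resolves s t (w , sing , ws , wt , between) =
      p w , (λ e → ws (sym (sing s e))) , (λ e → wt (sym (sing t e))) , strongly between
      where
      strongly : Between s t w ⊎ Between t s w → StronglyResolves G p (p w) s t
      strongly (inj₁ e) rewrite sd-single p s w sing | sd-single p t w sing = inj₁ e
      strongly (inj₂ e) rewrite sd-single p s w sing | sd-single p t w sing = inj₂ e

  inducedPath⇒Between : ∀ s t w → G s t ≡ true → G t w ≡ true → G s w ≡ false → s ≢ w →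
    Between s t w
  inducedPath⇒Between s t w g1 g2 ng ne rewrite dist2 s t w ne ng g1 g2 | dist1 s t g1 | dist1 t w g2 = refl

  noSRP0 : Fin n → ¬ HasSRP G 0
  noSRP0 x (p , _) with p x
  ... | ()

  noSRP1 : ∀ x y → x ≢ y → ¬ HasSRP G 1
  noSRP1 x y ne (p , _ , resolved) = proj₁ (proj₂ (resolved x y ne (fin1 (p x) (p y)))) (fin1 _ _)
    where fin1 : ∀ (a b : Fin 1) → a ≡ b
          fin1 fzero fzero = refl

open Resolving using (Between)

mergePair : ∀ {n} (G : Graph n) (simp : IsSimple G) → ∀ x y w → x ≢ y → w ≢ x → w ≢ y →
  Between G simp x y w → HasSRP G (n ∸ 1)
mergePair {suc m} G simp x y w xy wx wy between =
  singletonResolved⇒SRP p (merge-surj x y xy) resolver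
  where
  open Resolving G simp
  p = merge x y xy
  singleton : Singleton p w
  singleton v e = merge-fixes x y xy e wx wy
  resolver : ∀ s t → s ≢ t → p s ≡ p t → SingletonResolver p s t
  resolver s t st e with merge-eq x y xy s t e
  ... | inj₁ q = ⊥-elim (st q)
  ... | inj₂ (inj₁ (refl , refl)) = w , singleton , wx , wy , inj₁ between
  ... | inj₂ (inj₂ (refl , refl)) = w , singleton , wy , wx , inj₂ between

mergeTwoPairs : ∀ {n} (G : Graph n) (simp : IsSimple G) → ∀ x y u v w z →
  x ≢ y → x ≢ u → x ≢ v → y ≢ u → y ≢ v → u ≢ v →
  w ≢ x → w ≢ y → w ≢ u → w ≢ v → z ≢ x → z ≢ y → z ≢ u → z ≢ v →
  Between G simp x y w → Between G simp u v z → HasSRP G (n ∸ 2)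
mergeTwoPairs {suc zero} G simp fzero fzero u v w z xy _ _ _ _ _ _ _ _ _ _ _ _ _ _ _ = ⊥-elim (xy refl)
mergeTwoPairs {suc (suc m)} G simp x y u v w z xy xu xv yu yv uv wx wy wu wv zx zy zu zv r1 r2 =
  singletonResolved⇒SRP p (Comp.surjective _≡_ _≡_ _≡_ (merge-surj x y xy) (merge-surj _ _ uv′)) resolver
  where
  open Resolving G simp
  m₁ = merge x y xy
  uv′ : m₁ u ≢ m₁ v
  uv′ e = uv (merge-fixes x y xy e (≢-sym xv) (≢-sym yv))
  p = merge (m₁ u) (m₁ v) uv′ ∘ m₁
  classes : ∀ s t → p s ≡ p t → s ≡ t ⊎ Pair s t x y ⊎ Pair s t u v
  classes s t e with merge-eq (m₁ u) (m₁ v) uv′ (m₁ s) (m₁ t) e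
  ... | inj₁ q = Sum.map₂ inj₁ (merge-eq x y xy s t q)
  ... | inj₂ (inj₁ (a , b)) = inj₂ (inj₂ (inj₁ (merge-fixes x y xy a (≢-sym xu) (≢-sym yu) ,
                                               merge-fixes x y xy b (≢-sym xv) (≢-sym yv))))
  ... | inj₂ (inj₂ (a , b)) = inj₂ (inj₂ (inj₂ (merge-fixes x y xy a (≢-sym xv) (≢-sym yv) ,
                                               merge-fixes x y xy b (≢-sym xu) (≢-sym yu))))
  singleton : ∀ w′ → w′ ≢ x → w′ ≢ y → w′ ≢ u → w′ ≢ v → Singleton p w′
  singleton w′ a b c d v′ e with classes v′ w′ e
  ... | inj₁ q = q
  ... | inj₂ (inj₁ (inj₁ (_ , q))) = ⊥-elim (b q)
  ... | inj₂ (inj₁ (inj₂ (_ , q))) = ⊥-elim (a q)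
  ... | inj₂ (inj₂ (inj₁ (_ , q))) = ⊥-elim (d q)
  ... | inj₂ (inj₂ (inj₂ (_ , q))) = ⊥-elim (c q)
  resolver : ∀ s t → s ≢ t → p s ≡ p t → SingletonResolver p s t
  resolver s t st e with classes s t e
  ... | inj₁ q = ⊥-elim (st q)
  ... | inj₂ (inj₁ (inj₁ (refl , refl))) = w , singleton w wx wy wu wv , wx , wy , inj₁ r1
  ... | inj₂ (inj₁ (inj₂ (refl , refl))) = w , singleton w wx wy wu wv , wy , wx , inj₂ r1
  ... | inj₂ (inj₂ (inj₁ (refl , refl))) = z , singleton z zx zy zu zv , zu , zv , inj₁ r2
  ... | inj₂ (inj₂ (inj₂ (refl , refl))) = z , singleton z zx zy zu zv , zv , zu , inj₂ r2

OneOf3 : ∀ {n} → Fin n → Fin n → Fin n → Fin n → Set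
OneOf3 s x y z = s ≡ x ⊎ s ≡ y ⊎ s ≡ z

mergeTriple : ∀ {n} (G : Graph n) (simp : IsSimple G) → ∀ x y z w₁ w₂ w₃ →
  x ≢ y → x ≢ z → y ≢ z →
  w₁ ≢ x → w₁ ≢ y → w₁ ≢ z → w₂ ≢ x → w₂ ≢ y → w₂ ≢ z → w₃ ≢ x → w₃ ≢ y → w₃ ≢ z →
  Between G simp x y w₁ → Between G simp x z w₂ → Between G simp y z w₃ → HasSRP G (n ∸ 2)
mergeTriple {suc zero} G simp fzero fzero z _ _ _ xy _ _ _ _ _ _ _ _ _ _ _ _ _ _ = ⊥-elim (xy refl)
mergeTriple {suc (suc m)} G simp x y z w₁ w₂ w₃ xy xz yz a1 b1 c1 a2 b2 c2 a3 b3 c3 r1 r2 r3 =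
  singletonResolved⇒SRP p (Comp.surjective _≡_ _≡_ _≡_ (merge-surj x y xy) (merge-surj _ _ xz′)) resolver
  where
  open Resolving G simp
  m₁ = merge x y xy
  xz′ : m₁ x ≢ m₁ z
  xz′ e = xz (merge-fixes x y xy e (≢-sym xz) (≢-sym yz))
  p = merge (m₁ x) (m₁ z) xz′ ∘ m₁
  inTriple : ∀ {s} a → m₁ s ≡ m₁ a → OneOf3 a x y z → OneOf3 s x y z
  inTriple {s} a e a∈ with merge-eq x y xy s a e
  ... | inj₁ refl = a∈
  ... | inj₂ (inj₁ (q , _)) = inj₁ q
  ... | inj₂ (inj₂ (q , _)) = inj₂ (inj₁ q)
  classes : ∀ s t → p s ≡ p t → s ≡ t ⊎ (OneOf3 s x y z × OneOf3 t x y z)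
  classes s t e with merge-eq (m₁ x) (m₁ z) xz′ (m₁ s) (m₁ t) e
  ... | inj₁ q with merge-eq x y xy s t q
  ... | inj₁ q′ = inj₁ q′
  ... | inj₂ (inj₁ (a , b)) = inj₂ (inj₁ a , inj₂ (inj₁ b))
  ... | inj₂ (inj₂ (a , b)) = inj₂ (inj₂ (inj₁ a) , inj₁ b)
  classes s t e | inj₂ (inj₁ (a , b)) = inj₂ (inTriple x a (inj₁ refl) , inTriple z b (inj₂ (inj₂ refl)))
  classes s t e | inj₂ (inj₂ (a , b)) = inj₂ (inTriple z a (inj₂ (inj₂ refl)) , inTriple x b (inj₁ refl))
  singleton : ∀ w′ → w′ ≢ x → w′ ≢ y → w′ ≢ z → Singleton p w′
  singleton w′ a b c v′ e with classes v′ w′ e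
  ... | inj₁ q = q
  ... | inj₂ (_ , inj₁ q) = ⊥-elim (a q)
  ... | inj₂ (_ , inj₂ (inj₁ q)) = ⊥-elim (b q)
  ... | inj₂ (_ , inj₂ (inj₂ q)) = ⊥-elim (c q)
  resolver : ∀ s t → s ≢ t → p s ≡ p t → SingletonResolver p s t
  resolver s t st e with classes s t e
  ... | inj₁ q = ⊥-elim (st q)
  ... | inj₂ (inj₁ refl , inj₁ refl) = ⊥-elim (st refl)
  ... | inj₂ (inj₂ (inj₁ refl) , inj₂ (inj₁ refl)) = ⊥-elim (st refl)
  ... | inj₂ (inj₂ (inj₂ refl) , inj₂ (inj₂ refl)) = ⊥-elim (st refl)
  ... | inj₂ (inj₁ refl , inj₂ (inj₁ refl)) = w₁ , singleton w₁ a1 b1 c1 , a1 , b1 , inj₁ r1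
  ... | inj₂ (inj₂ (inj₁ refl) , inj₁ refl) = w₁ , singleton w₁ a1 b1 c1 , b1 , a1 , inj₂ r1
  ... | inj₂ (inj₁ refl , inj₂ (inj₂ refl)) = w₂ , singleton w₂ a2 b2 c2 , a2 , c2 , inj₁ r2
  ... | inj₂ (inj₂ (inj₂ refl) , inj₁ refl) = w₂ , singleton w₂ a2 b2 c2 , c2 , a2 , inj₂ r2
  ... | inj₂ (inj₂ (inj₁ refl) , inj₂ (inj₂ refl)) = w₃ , singleton w₃ a3 b3 c3 , b3 , c3 , inj₁ r3
  ... | inj₂ (inj₂ (inj₂ refl) , inj₂ (inj₁ refl)) = w₃ , singleton w₃ a3 b3 c3 , c3 , b3 , inj₂ r3

sum≤2⇒both1 : ∀ b c → b + c ≤ 2 → 1 ≤ b → 1 ≤ c → b ≡ 1 × c ≡ 1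
sum≤2⇒both1 (suc zero) (suc zero) _ _ _ = refl , refl
sum≤2⇒both1 (suc zero) (suc (suc c)) (s≤s (s≤s ())) _ _
sum≤2⇒both1 (suc (suc zero)) (suc c) (s≤s (s≤s ())) _ _
sum≤2⇒both1 (suc (suc (suc b))) (suc c) (s≤s (s≤s ())) _ _

module DiameterTwo {n} (G : Graph n) (simp : IsSimple G) (diam2 : ∀ u v → reach G 2 u v ≡ true) where
  open Reach G
  open Distance G simp

  Orient : ∀ {k} → (Fin n → Fin k) → Fin n → Fin n → Fin k → Set
  Orient p s t j = G s t ≡ true × (∀ v → p v ≡ j → G s v ≡ false) × ∃ λ v → p v ≡ j × G t v ≡ true

  -- d(s,W) = d(s,t) + d(t,W) with d(s,W) ≤ 2 and both summands positive forces
  -- d(s,t) = d(t,W) = 1 and d(s,W) = 2.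
  resolution⇒Orient : ∀ {k} (p : Fin n → Fin k) s t j → s ≢ t → ¬ (p s ≡ j) → ¬ (p t ≡ j) →
    (∃ λ v → p v ≡ j) → setDist G p s j ≡ dist G s t + setDist G p t j → Orient p s t j
  resolution⇒Orient p s t j ne ps pt (v₀ , pv₀) eq = adjacent , farFromS , nearT
    where
    ds≤2 : setDist G p s j ≤ 2
    ds≤2 = ≤-trans (sd-le p s j v₀ pv₀) (dist-min 2 s v₀ (diam2 s v₀))
    dt≥1 : 1 ≤ setDist G p t j
    dt≥1 = sd-ge p t j 1 (λ v pv → dist-pos t v (λ e → pt (trans (cong p e) pv))) (one≤ t)
    ones = sum≤2⇒both1 (dist G s t) (setDist G p t j) (subst (_≤ 2) eq ds≤2) (dist-pos s t ne) dt≥1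
    ds≡2 : setDist G p s j ≡ 2
    ds≡2 = trans eq (cong₂ _+_ (proj₁ ones) (proj₂ ones))
    adjacent = dist1→adj s t ne (proj₁ ones)
    farFromS : ∀ v → p v ≡ j → G s v ≡ false
    farFromS v pv = ≢true⇒false λ g → <-irrefl refl
      (subst (_≤ 1) ds≡2 (subst (setDist G p s j ≤_) (dist1 s v g) (sd-le p s j v pv)))
    nearT : ∃ λ v → p v ≡ j × G t v ≡ true
    nearT with sd-attain p t j
    ... | inj₁ e = ⊥-elim (<-irrefl refl (subst (2 ≤_) (trans (sym e) (proj₂ ones)) (two-distinct s t ne)))
    ... | inj₂ (v , pv , e) = v , pv , dist1→adj t v (λ q → pt (trans (cong p q) pv)) (trans (sym e) (proj₂ ones))

  sameClass⇒Orient : ∀ {k} (p : Fin n → Fin k) → IsStrongResolvingPartition G p →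
    ∀ x y → x ≢ y → p x ≡ p y → ∃ λ j → ¬ (p x ≡ j) × (Orient p x y j ⊎ Orient p y x j)
  sameClass⇒Orient p (surj , resolved) x y ne pe with resolved x y ne pe
  ... | j , px , py , sr = j , px , orient sr
    where
    nonempty : ∃ λ v → p v ≡ j
    nonempty = let v , h = surj j in v , h refl
    orient : StronglyResolves G p j x y → Orient p x y j ⊎ Orient p y x j
    orient (inj₁ e) = inj₁ (resolution⇒Orient p x y j ne px py nonempty e)
    orient (inj₂ e) = inj₂ (resolution⇒Orient p y x j (ne ∘ sym) py px nonempty e)

  sameClass⇒adjacent : ∀ {k} (p : Fin n → Fin k) → IsStrongResolvingPartition G p →
    ∀ x y → x ≢ y → p x ≡ p y → G x y ≡ true
  sameClass⇒adjacent p srp x y ne pe with sameClass⇒Orient p srp x y ne pe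
  ... | _ , _ , inj₁ (gxy , _) = gxy
  ... | _ , _ , inj₂ (gyx , _) = adj-sym gyx

  orientedPair : ∀ {k} (p : Fin n → Fin k) → IsStrongResolvingPartition G p → ∀ x y → x ≢ y → p x ≡ p y →
    ∃ λ s → ∃ λ t → ∃ λ j → s ≢ t × p s ≡ p t × ¬ (p s ≡ j) × Orient p s t j × Pair s t x y
  orientedPair p srp x y xy pe with sameClass⇒Orient p srp x y xy pe
  ... | j , px , inj₁ o = x , y , j , xy , pe , px , o , inj₁ (refl , refl)
  ... | j , px , inj₂ o = y , x , j , xy ∘ sym , sym pe , px ∘ trans pe , o , inj₂ (refl , refl)

module Bijection {n m} (f : Fin n ↔ Fin m) where
  to = Inverse.to f
  from = Inverse.from f

  to-from : ∀ y → to (from y) ≡ y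
  to-from = Inverse.strictlyInverseˡ f

  from-to : ∀ x → from (to x) ≡ x
  from-to = Inverse.strictlyInverseʳ f

  to-inj : ∀ {x y} → to x ≡ to y → x ≡ y
  to-inj {x} {y} e = trans (sym (from-to x)) (trans (cong from e) (from-to y))

  from-inj : ∀ {x y} → from x ≡ from y → x ≡ y
  from-inj {x} {y} e = trans (sym (to-from x)) (trans (cong to e) (to-from y))

  n≡m : n ≡ m
  n≡m = FP.cantor-schröder-bernstein {f = to} {g = from} to-inj from-inj

≅-byInverse : ∀ {n m} {G : Graph n} {H : Graph m} (π : Fin n ↔ Fin m) →
  (∀ i j → H i j ≡ G (Inverse.from π i) (Inverse.from π j)) → G ≅ H
≅-byInverse {G = G} π table = π , λ x y → trans (table _ _) (cong₂ G (from-to x) (from-to y))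
  where open Bijection π

module Isomorphic {n m} (G : Graph n) (H : Graph m) (f : Fin n ↔ Fin m)
  (iso : ∀ x y → H (Inverse.to f x) (Inverse.to f y) ≡ G x y) where
  open Bijection f public

  adj-from : ∀ i j → G (from i) (from j) ≡ H i j
  adj-from i j = trans (sym (iso (from i) (from j))) (cong₂ H (to-from i) (to-from j))

  from-≢ : ∀ {i j} → i ≢ j → from i ≢ from j
  from-≢ ne e = ne (from-inj e)

  reach-iso : ∀ k x y → reach H k (to x) (to y) ≡ reach G k x y
  reach-iso zero x y = bool-ext (λ e → ≡⇒≟-true x y (to-inj (≟-true⇒≡ _ _ e)))
                                (λ e → ≡⇒≟-true _ _ (cong to (≟-true⇒≡ _ _ e)))
  reach-iso (suc k) x y = cong₂ _∨_ (reach-iso k x y) (bool-ext fromH toH)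
    where
    fromH : any (λ z → H (to x) z ∧ reach H k z (to y)) (allFin m) ≡ true →
            any (λ z → G x z ∧ reach G k z y) (allFin n) ≡ true
    fromH e with any-allFin⇒ _ e
    ... | z , ez with ∧-true ez
    ... | e1 , e2 = any-allFin⇐ _ (from z)
          (∧-intro (trans (sym (iso x (from z))) (subst (λ q → H (to x) q ≡ true) (sym (to-from z)) e1))
                   (trans (sym (reach-iso k (from z) y)) (subst (λ q → reach H k q (to y) ≡ true) (sym (to-from z)) e2)))
    toH : any (λ z → G x z ∧ reach G k z y) (allFin n) ≡ true →
          any (λ z → H (to x) z ∧ reach H k z (to y)) (allFin m) ≡ true
    toH e with any-allFin⇒ _ e
    ... | z , ez with ∧-true ez
    ... | e1 , e2 = any-allFin⇐ _ (to z) (∧-intro (trans (iso x z) e1) (trans (reach-iso k z y) e2))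

transpose-matchˡ : ∀ {n} (i j : Fin n) → PC.transpose i j i ≡ j
transpose-matchˡ i j with i F.≟ i
... | yes _ = refl
... | no q = ⊥-elim (q refl)

transpose-matchʳ : ∀ {n} (i j : Fin n) → PC.transpose i j j ≡ i
transpose-matchʳ i j with j F.≟ i
... | yes e = e
... | no _ with j F.≟ j
...   | yes _ = refl
...   | no q = ⊥-elim (q refl)

transpose-other : ∀ {n} (i j k : Fin n) → k ≢ i → k ≢ j → PC.transpose i j k ≡ k
transpose-other i j k ki kj with k F.≟ i
... | yes e = ⊥-elim (ki e)
... | no _ with k F.≟ j
...   | yes e = ⊥-elim (kj e)
...   | no _ = refl

-- P₃: merging an end with the centre leaves two classes, and one class never suffices.
module Path3 {n} (G : Graph n) (simp : IsSimple G)
  (f : Fin n ↔ Fin 3) (iso : ∀ x y → P3 (Inverse.to f x) (Inverse.to f y) ≡ G x y) where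
  open Isomorphic G P3 f iso
  open Resolving G simp

  v₀ v₁ v₂ : Fin n
  v₀ = from fzero
  v₁ = from (fsuc fzero)
  v₂ = from (fsuc (fsuc fzero))

  pds : PdsEq G (n ∸ 1)
  pds = mergePair G simp v₀ v₁ v₂ (from-≢ λ ()) (from-≢ λ ()) (from-≢ λ ())
          (inducedPath⇒Between v₀ v₁ v₂ (adj-from _ _) (adj-from _ _) (adj-from _ _) (from-≢ λ ()))
      , λ k lt → lower k (subst (λ q → k < q ∸ 1) n≡m lt)
    where
    lower : ∀ k → k < 2 → ¬ HasSRP G k
    lower zero _ = noSRP0 v₀
    lower (suc zero) _ = noSRP1 v₀ v₁ (from-≢ λ ())
    lower (suc (suc k)) (s≤s (s≤s ()))

fin2-other : ∀ {a b c : Fin 2} → a ≢ b → c ≢ a → c ≡ b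
fin2-other {fzero} {fzero} ab _ = ⊥-elim (ab refl)
fin2-other {fzero} {fsuc fzero} {fzero} _ ca = ⊥-elim (ca refl)
fin2-other {fzero} {fsuc fzero} {fsuc fzero} _ _ = refl
fin2-other {fsuc fzero} {fzero} {fzero} _ _ = refl
fin2-other {fsuc fzero} {fzero} {fsuc fzero} _ ca = ⊥-elim (ca refl)
fin2-other {fsuc fzero} {fsuc fzero} ab _ = ⊥-elim (ab refl)

C4-diameter2 : ∀ i j → reach C4 2 i j ≡ true
C4-diameter2 = from-yes (FP.all? λ i → FP.all? λ j → reach C4 2 i j Data.Bool.≟ true)

-- C₄: merging two adjacent vertices leaves three classes; two classes are impossible since
-- opposite vertices must be separated, and then each class is a side of the square.
module Cycle4 {n} (G : Graph n) (simp : IsSimple G)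
  (f : Fin n ↔ Fin 4) (iso : ∀ x y → C4 (Inverse.to f x) (Inverse.to f y) ≡ G x y) where
  open Isomorphic G C4 f iso
  open Distance G simp
  open Resolving G simp

  diam2 : ∀ x y → reach G 2 x y ≡ true
  diam2 x y = trans (sym (reach-iso 2 x y)) (C4-diameter2 (to x) (to y))

  open DiameterTwo G simp diam2

  v₀ v₁ v₂ v₃ : Fin n
  v₀ = from fzero
  v₁ = from (fsuc fzero)
  v₂ = from (fsuc (fsuc fzero))
  v₃ = from (fsuc (fsuc (fsuc fzero)))

  sidesUnresolved : ∀ (p : Fin n → Fin 2) → IsStrongResolvingPartition G p → ∀ a b c d →
    a ≢ b → p a ≡ p b → p c ≡ p d → p a ≢ p c → G a d ≡ true → G b c ≡ true → ⊥
  sidesUnresolved p srp a b c d ab pab pcd ac gad gbc with sameClass⇒Orient p srp a b ab pab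
  ... | j , paj , orientation with fin2-other ac (paj ∘ sym)
  ... | refl with orientation
  ... | inj₁ (_ , farA , _) = t≢f (trans (sym gad) (farA d (sym pcd)))
  ... | inj₂ (_ , farB , _) = t≢f (trans (sym gbc) (farB c refl))

  noSRP2 : ¬ HasSRP G 2
  noSRP2 (p , srp) = twoSides (p v₁ F.≟ p v₀)
    where
    p02 : p v₀ ≢ p v₂
    p02 e = t≢f (trans (sym (sameClass⇒adjacent p srp v₀ v₂ (from-≢ λ ()) e)) (adj-from _ _))
    p13 : p v₁ ≢ p v₃
    p13 e = t≢f (trans (sym (sameClass⇒adjacent p srp v₁ v₃ (from-≢ λ ()) e)) (adj-from _ _))
    twoSides : Dec (p v₁ ≡ p v₀) → ⊥
    twoSides (yes e) = sidesUnresolved p srp v₀ v₁ v₂ v₃ (from-≢ λ ()) (sym e)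
      (sym (fin2-other p02 (p13 ∘ trans e ∘ sym))) p02 (adj-from _ _) (adj-from _ _)
    twoSides (no ne) = sidesUnresolved p srp v₁ v₂ v₃ v₀ (from-≢ λ ()) e12
      (fin2-other (p02 ∘ sym) (p13 ∘ trans e12 ∘ sym)) p13 (adj-from _ _) (adj-from _ _)
      where e12 = fin2-other p02 ne

  pds : PdsEq G (n ∸ 1)
  pds = mergePair G simp v₀ v₁ v₂ (from-≢ λ ()) (from-≢ λ ()) (from-≢ λ ())
          (inducedPath⇒Between v₀ v₁ v₂ (adj-from _ _) (adj-from _ _) (adj-from _ _) (from-≢ λ ()))
      , λ k lt → lower k (subst (λ q → k < q ∸ 1) n≡m lt)
    where
    lower : ∀ k → k < 3 → ¬ HasSRP G k
    lower zero _ = noSRP0 v₀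
    lower (suc zero) _ = noSRP1 v₀ v₁ (from-≢ λ ())
    lower (suc (suc zero)) _ = noSRP2
    lower (suc (suc (suc k))) (s≤s (s≤s (s≤s ())))

≡ᵇ-true⇒≡ : ∀ a b → (a ≡ᵇ b) ≡ true → a ≡ b
≡ᵇ-true⇒≡ a b e = ≡ᵇ⇒≡ a b (subst T (sym e) _)

firstStep : ∀ {n} {G : Graph n} {x y k} → Walk G x y k → x ≢ y → ∃ λ z → G x z ≡ true
firstStep here ne = ⊥-elim (ne refl)
firstStep (step {y = z} g _) _ = z , g

-- Kₙ - e: the ends a, b of the missing edge have a common neighbour z (by connectivity), so
-- merging a with z leaves n - 1 classes.  A resolving orientation s → t must start at an end of
-- e and then the other end is alone in its class; so either {a} is a class and all vertices but b
-- are in distinct classes, or all vertices but a are.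
module CompleteMinusEdge {n m} (G : Graph n) (simp : IsSimple G) (conn : Connected G)
  (f : Fin n ↔ Fin (suc (suc m))) (iso : ∀ x y → KminusE m (Inverse.to f x) (Inverse.to f y) ≡ G x y) where
  open Bijection f
  open Reach G
  open Distance G simp
  open Resolving G simp

  a b : Fin n
  a = from fzero
  b = from (fsuc fzero)

  ab : a ≢ b
  ab e with from-inj e
  ... | ()

  missing : G a b ≡ false
  missing rewrite sym (iso a b) | to-from fzero | to-from (fsuc {suc m} fzero) = refl

  toℕ≡0 : ∀ x → toℕ (to x) ≡ 0 → x ≡ a
  toℕ≡0 x e = trans (sym (from-to x)) (cong from (FP.toℕ-injective {j = fzero} e))

  toℕ≡1 : ∀ x → toℕ (to x) ≡ 1 → x ≡ b
  toℕ≡1 x e = trans (sym (from-to x)) (cong from (FP.toℕ-injective {j = fsuc fzero} e))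

  nonEdge : ∀ x y → G x y ≡ false → x ≡ y ⊎ Pair x y a b
  nonEdge x y g = cases (toℕ (to x) ≡ᵇ toℕ (to y)) ((toℕ (to x) ≡ᵇ 0) ∧ (toℕ (to y) ≡ᵇ 1))
                        ((toℕ (to x) ≡ᵇ 1) ∧ (toℕ (to y) ≡ᵇ 0)) refl refl refl (trans (iso x y) g)
    where
    cases : ∀ A B C → (toℕ (to x) ≡ᵇ toℕ (to y)) ≡ A → (toℕ (to x) ≡ᵇ 0) ∧ (toℕ (to y) ≡ᵇ 1) ≡ B →
      (toℕ (to x) ≡ᵇ 1) ∧ (toℕ (to y) ≡ᵇ 0) ≡ C → not A ∧ not (B ∨ C) ≡ false → x ≡ y ⊎ Pair x y a b
    cases true _ _ eA _ _ _ = inj₁ (to-inj (FP.toℕ-injective (≡ᵇ-true⇒≡ _ _ eA)))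
    cases false true _ _ eB _ _ = inj₂ (inj₁ (toℕ≡0 x (≡ᵇ-true⇒≡ _ _ (proj₁ (∧-true eB))) ,
                                             toℕ≡1 y (≡ᵇ-true⇒≡ _ _ (proj₂ (∧-true eB)))))
    cases false false true _ _ eC _ = inj₂ (inj₂ (toℕ≡1 x (≡ᵇ-true⇒≡ _ _ (proj₁ (∧-true eC))) ,
                                                 toℕ≡0 y (≡ᵇ-true⇒≡ _ _ (proj₂ (∧-true eC)))))

  z : Fin n
  z = proj₁ (firstStep (proj₂ (conn a b)) ab)

  az : G a z ≡ true
  az = proj₂ (firstStep (proj₂ (conn a b)) ab)

  zb : G z b ≡ true
  zb = ≢false⇒true λ g → notPair (nonEdge z b g)
    where
    notPair : z ≡ b ⊎ Pair z b a b → ⊥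
    notPair (inj₁ q) = t≢f (trans (sym az) (trans (cong (G a) q) missing))
    notPair (inj₂ (inj₁ (q , _))) = adj≢ az (sym q)
    notPair (inj₂ (inj₂ (q , _))) = t≢f (trans (sym az) (trans (cong (G a) q) missing))

  diam2 : ∀ u v → reach G 2 u v ≡ true
  diam2 u v with G u v in e
  ... | true = reach-mono 1 u v (reach1← u v e)
  ... | false with nonEdge u v e
  ... | inj₁ refl = reach-refl 2 u
  ... | inj₂ (inj₁ (refl , refl)) = reach2← a z b az zb
  ... | inj₂ (inj₂ (refl , refl)) = reach2← b z a (adj-sym zb) (adj-sym az)

  open DiameterTwo G simp diam2

  orientedFromEnd : ∀ {k} (p : Fin n → Fin k) s t j → ¬ (p s ≡ j) → Orient p s t j →
    (s ≡ a × Singleton p b) ⊎ (s ≡ b × Singleton p a)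
  orientedFromEnd p s t j ps (_ , far , v₀ , pv₀ , _) with nonEdge s v₀ (far v₀ pv₀)
  ... | inj₁ refl = ⊥-elim (ps pv₀)
  ... | inj₂ (inj₁ (refl , refl)) = inj₁ (refl , λ v e → onlyB v (trans e pv₀) (far v (trans e pv₀)))
    where onlyB : ∀ v → p v ≡ j → G s v ≡ false → v ≡ b
          onlyB v pv g with nonEdge s v g
          ... | inj₁ refl = ⊥-elim (ps pv)
          ... | inj₂ (inj₁ (_ , q)) = q
          ... | inj₂ (inj₂ (q , _)) = ⊥-elim (ab q)
  ... | inj₂ (inj₂ (refl , refl)) = inj₂ (refl , λ v e → onlyA v (trans e pv₀) (far v (trans e pv₀)))
    where onlyA : ∀ v → p v ≡ j → G s v ≡ false → v ≡ a
          onlyA v pv g with nonEdge s v g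
          ... | inj₁ refl = ⊥-elim (ps pv)
          ... | inj₂ (inj₁ (q , _)) = ⊥-elim (ab (sym q))
          ... | inj₂ (inj₂ (_ , q)) = q

  lower : ∀ k → k < n ∸ 1 → ¬ HasSRP G k
  lower k lt (p , srp) with FP.all? (λ v → (p v F.≟ p a) →-dec (v F.≟ a))
  ... | yes aAlone = <-irrefl refl (<-≤-trans lt (injectiveAway⇒≤ p b apartAwayFromB))
    where
    apartAwayFromB : ∀ x y → x ≢ b → y ≢ b → x ≢ y → p x ≢ p y
    apartAwayFromB x y xb yb xy pe with orientedPair p srp x y xy pe
    ... | s , t , j , st , pst , ps , o , sxy with orientedFromEnd p s t j ps o
    ... | inj₁ (refl , _) = st (sym (aAlone t (sym pst)))
    ... | inj₂ (refl , _) = Sum.[ xb ∘ sym ∘ proj₁ , yb ∘ sym ∘ proj₁ ] sxy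
  ... | no aShared = <-irrefl refl (<-≤-trans lt (injectiveAway⇒≤ p a apartAwayFromA))
    where
    apartAwayFromA : ∀ x y → x ≢ a → y ≢ a → x ≢ y → p x ≢ p y
    apartAwayFromA x y xa ya xy pe with orientedPair p srp x y xy pe
    ... | s , t , j , st , pst , ps , o , sxy with orientedFromEnd p s t j ps o
    ... | inj₁ (refl , _) = Sum.[ xa ∘ sym ∘ proj₁ , ya ∘ sym ∘ proj₁ ] sxy
    ... | inj₂ (refl , aAlone) = aShared aAlone

  pds : PdsEq G (n ∸ 1)
  pds = mergePair G simp a z b (adj≢ az) (≢-sym ab) (≢-sym (adj≢ zb))
          (inducedPath⇒Between a z b az zb missing ab) , lower

-- K₁ + ⋃ᵢ K_{nᵢ}: the apex α is adjacent to every vertex and adjacency among the other vertices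
-- is transitive (they form disjoint cliques).  Merging vertices x, y of two different cliques
-- (α lies between them) leaves n - 1 classes.  Conversely an orientation s → t towards a class
-- W is impossible when s, t ≠ α (the neighbour of t in W is α or a clique-mate of s), so no two
-- vertices other than α share a class.
module JoinOfCliques {n m r} (G : Graph n) (simp : IsSimple G) (c : Fin m → Fin r)
  (csurj : Surjective _≡_ _≡_ c) (r2 : 2 ≤ r)
  (f : Fin n ↔ Fin (suc m)) (iso : ∀ x y → K1Join c (Inverse.to f x) (Inverse.to f y) ≡ G x y) where
  open Bijection f
  open Reach G
  open Distance G simp
  open Resolving G simp

  α : Fin n
  α = from fzero

  nonApex : ∀ x → x ≢ α → ∃ λ i → to x ≡ fsuc i
  nonApex x ne with to x in eq
  ... | fzero = ⊥-elim (ne (trans (sym (from-to x)) (cong from eq)))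
  ... | fsuc i = i , refl

  apexAdj : ∀ x → x ≢ α → G α x ≡ true
  apexAdj x ne with nonApex x ne
  ... | i , e rewrite sym (iso α x) | to-from fzero | e = refl

  sameClique : ∀ x y i i′ → to x ≡ fsuc i → to y ≡ fsuc i′ → G x y ≡ true → c i ≡ c i′
  sameClique x y i i′ ex ey g rewrite sym (iso x y) | ex | ey =
    ≟-true⇒≡ _ _ (proj₂ (∧-true {not ⌊ i F.≟ i′ ⌋} g))

  cliqueAdj : ∀ x y i i′ → to x ≡ fsuc i → to y ≡ fsuc i′ → i ≢ i′ → c i ≡ c i′ → G x y ≡ true
  cliqueAdj x y i i′ ex ey ne ce rewrite sym (iso x y) | ex | ey | ≢⇒≟-false i i′ ne | ≡⇒≟-true (c i) (c i′) ce = refl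

  cliquesTransitive : ∀ x y z → x ≢ α → y ≢ α → z ≢ α → x ≢ z →
    G x y ≡ true → G y z ≡ true → G x z ≡ true
  cliquesTransitive x y z xα yα zα xz g1 g2 with nonApex x xα | nonApex y yα | nonApex z zα
  ... | i , ex | i′ , ey | i″ , ez =
    cliqueAdj x z i i″ ex ez (λ q → xz (to-inj (trans ex (trans (cong fsuc q) (sym ez)))))
      (trans (sameClique x y i i′ ex ey g1) (sameClique y z i′ i″ ey ez g2))

  diam2 : ∀ u v → reach G 2 u v ≡ true
  diam2 u v with u F.≟ α | v F.≟ α
  ... | yes refl | yes refl = reach-refl 2 α
  ... | yes refl | no vα = reach-mono 1 α v (reach1← α v (apexAdj v vα))
  ... | no uα | yes refl = reach-mono 1 u α (reach1← u α (adj-sym (apexAdj u uα)))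
  ... | no uα | no vα = reach2← u α v (adj-sym (apexAdj u uα)) (apexAdj v vα)

  open DiameterTwo G simp diam2

  two-elems : ∀ {r′} → 2 ≤ r′ → Σ (Fin r′) λ a → Σ (Fin r′) λ b → a ≢ b
  two-elems {suc zero} (s≤s ())
  two-elems {suc (suc r′)} _ = fzero , fsuc fzero , λ ()

  upper : HasSRP G (n ∸ 1)
  upper with two-elems r2
  ... | k₀ , k₁ , k₀k₁ with csurj k₀ | csurj k₁
  ... | i₀ , h₀ | i₁ , h₁ =
    mergePair G simp x α y xα (≢-sym xy) yα (inducedPath⇒Between x α y (adj-sym (apexAdj x xα)) (apexAdj y yα) nonadj xy)
    where
    x = from (fsuc i₀)
    y = from (fsuc i₁)
    xα : x ≢ α
    xα e with from-inj e
    ... | ()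
    yα : y ≢ α
    yα e with from-inj e
    ... | ()
    differentCliques : c i₀ ≢ c i₁
    differentCliques e = k₀k₁ (trans (sym (h₀ refl)) (trans e (h₁ refl)))
    nonadj : G x y ≡ false
    nonadj = ≢true⇒false λ g → differentCliques (sameClique x y i₀ i₁ (to-from _) (to-from _) g)
    xy : x ≢ y
    xy e = differentCliques (cong c (FP.suc-injective (from-inj e)))

  noOrientation : ∀ {k} (p : Fin n → Fin k) s t j → s ≢ α → t ≢ α → ¬ (p s ≡ j) → Orient p s t j → ⊥
  noOrientation p s t j sα tα ps (st , far , v , pv , tv) with v F.≟ α
  ... | yes refl = t≢f (trans (sym (adj-sym (apexAdj s sα))) (far v pv))
  ... | no vα = t≢f (trans (sym (cliquesTransitive s t v sα tα vα (λ q → ps (trans (cong p q) pv)) st tv)) (far v pv))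

  lower : ∀ k → k < n ∸ 1 → ¬ HasSRP G k
  lower k lt (p , srp) = <-irrefl refl (<-≤-trans lt (injectiveAway⇒≤ p α apartAwayFromApex))
    where
    apartAwayFromApex : ∀ x y → x ≢ α → y ≢ α → x ≢ y → p x ≢ p y
    apartAwayFromApex x y xα yα xy pe with orientedPair p srp x y xy pe
    ... | s , t , j , st , _ , ps , o , inj₁ (refl , refl) = noOrientation p s t j xα yα ps o
    ... | s , t , j , st , _ , ps , o , inj₂ (refl , refl) = noOrientation p s t j yα xα ps o

  pds : PdsEq G (n ∸ 1)
  pds = upper , lower

quotientFin : ∀ m (R : Fin m → Fin m → Set) → (∀ i j → Dec (R i j)) → (∀ i → R i i) →
  (∀ i j → R i j → R j i) → (∀ i j k → R i j → R j k → R i k) →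
  ∃ λ r → Σ (Fin m → Fin r) λ c → Surjective _≡_ _≡_ c ×
    (∀ i j → c i ≡ c j → R i j) × (∀ i j → R i j → c i ≡ c j)
quotientFin zero R _ _ _ _ = zero , (λ ()) , (λ ()) , (λ ()) , (λ ())
quotientFin (suc m) R dec rfl sy tr
  with quotientFin m (λ i j → R (fsuc i) (fsuc j)) (λ _ _ → dec _ _) (λ _ → rfl _)
                     (λ _ _ → sy _ _) (λ _ _ _ → tr _ _ _)
     | FP.any? (λ i → dec fzero (fsuc i))
-- 0 is related to some i₀ > 0: send it to the class of i₀.
... | r , c , surj , sound , complete | yes (i₀ , R0i₀) = r , c′ , surj′ , sound′ , complete′
  where
  c′ : Fin (suc m) → Fin r
  c′ fzero = c i₀
  c′ (fsuc j) = c j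
  surj′ : Surjective _≡_ _≡_ c′
  surj′ y = let x , h = surj y in fsuc x , λ { refl → h refl }
  sound′ : ∀ i j → c′ i ≡ c′ j → R i j
  sound′ fzero fzero _ = rfl _
  sound′ fzero (fsuc j) e = tr _ _ _ R0i₀ (sound i₀ j e)
  sound′ (fsuc i) fzero e = tr _ _ _ (sound i i₀ e) (sy _ _ R0i₀)
  sound′ (fsuc i) (fsuc j) e = sound i j e
  complete′ : ∀ i j → R i j → c′ i ≡ c′ j
  complete′ fzero fzero _ = refl
  complete′ fzero (fsuc j) e = complete i₀ j (tr _ _ _ (sy _ _ R0i₀) e)
  complete′ (fsuc i) fzero e = complete i i₀ (tr _ _ _ e R0i₀)
  complete′ (fsuc i) (fsuc j) e = complete i j e
-- 0 is alone: give it a new class.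
... | r , c , surj , sound , complete | no alone = suc r , c′ , surj′ , sound′ , complete′
  where
  c′ : Fin (suc m) → Fin (suc r)
  c′ fzero = fzero
  c′ (fsuc j) = fsuc (c j)
  surj′ : Surjective _≡_ _≡_ c′
  surj′ fzero = fzero , λ { refl → refl }
  surj′ (fsuc y) = let x , h = surj y in fsuc x , λ { refl → cong fsuc (h refl) }
  sound′ : ∀ i j → c′ i ≡ c′ j → R i j
  sound′ fzero fzero _ = rfl _
  sound′ (fsuc i) (fsuc j) e = sound i j (FP.suc-injective e)
  complete′ : ∀ i j → R i j → c′ i ≡ c′ j
  complete′ fzero fzero _ = refl
  complete′ fzero (fsuc j) e = ⊥-elim (alone (j , e))
  complete′ (fsuc i) fzero e = ⊥-elim (alone (i , sy _ _ e))
  complete′ (fsuc i) (fsuc j) e = cong fsuc (complete i j e)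

-- A graph with a universal vertex u, transitive adjacency among the other vertices and a
-- non-adjacent pair is K₁ + ⋃ K_{nᵢ} with at least two cliques: u becomes the apex and the
-- cliques are the classes of "equal or adjacent" among the other vertices.
recogniseK1Join : ∀ {n} (G : Graph n) (simp : IsSimple G) (u : Fin n) → (∀ v → v ≢ u → G u v ≡ true) →
  (∀ x y z → x ≢ u → y ≢ u → z ≢ u → x ≢ z → G x y ≡ true → G y z ≡ true → G x z ≡ true) →
  (a a′ : Fin n) → a ≢ a′ → G a a′ ≡ false →
  ∃[ m ] ∃[ r ] Σ (Fin m → Fin r) λ c → Surjective _≡_ _≡_ c × 2 ≤ r × (G ≅ K1Join c)
recogniseK1Join {suc m} G simp u universal transitive a a′ aa′ gaa′ =
  m , r , c , surj , twoCliques , ≅-byInverse π table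
  where
  open Distance G simp
  π = transpose u fzero
  open Bijection π
  apex : from fzero ≡ u
  apex = transpose-matchˡ fzero u
  -- the i-th vertex other than u
  h : Fin m → Fin (suc m)
  h i = from (fsuc i)
  h≢u : ∀ i → h i ≢ u
  h≢u i e with trans (sym (to-from (fsuc i))) (trans (cong to e) (transpose-matchˡ u fzero))
  ... | ()
  h-inj : ∀ {i j} → h i ≡ h j → i ≡ j
  h-inj e = FP.suc-injective (from-inj e)
  R : Fin m → Fin m → Set
  R i j = i ≡ j ⊎ G (h i) (h j) ≡ true
  R-sym : ∀ i j → R i j → R j i
  R-sym i j (inj₁ e) = inj₁ (sym e)
  R-sym i j (inj₂ g) = inj₂ (adj-sym g)
  R-trans : ∀ i j k → R i j → R j k → R i k
  R-trans i j k (inj₁ refl) r = r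
  R-trans i j k (inj₂ g) (inj₁ refl) = inj₂ g
  R-trans i j k (inj₂ g₁) (inj₂ g₂) with i F.≟ k
  ... | yes e = inj₁ e
  ... | no ne = inj₂ (transitive (h i) (h j) (h k) (h≢u i) (h≢u j) (h≢u k) (ne ∘ h-inj) g₁ g₂)
  Q = quotientFin m R (λ i j → (i F.≟ j) ⊎-dec (G (h i) (h j) Data.Bool.≟ true)) (λ _ → inj₁ refl) R-sym R-trans
  r = proj₁ Q
  c = proj₁ (proj₂ Q)
  surj = proj₁ (proj₂ (proj₂ Q))
  sound = proj₁ (proj₂ (proj₂ (proj₂ Q)))
  complete = proj₂ (proj₂ (proj₂ (proj₂ Q)))
  preimage : ∀ x → x ≢ u → ∃ λ i → h i ≡ x
  preimage x ne with to x in eq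
  ... | fzero = ⊥-elim (ne (to-inj (trans eq (sym (transpose-matchˡ u fzero)))))
  ... | fsuc i = i , trans (cong from (sym eq)) (from-to x)
  au : a ≢ u
  au refl = t≢f (trans (sym (universal a′ (aa′ ∘ sym))) gaa′)
  a′u : a′ ≢ u
  a′u refl = t≢f (trans (sym (adj-sym (universal a aa′))) gaa′)
  twoCliques : 2 ≤ r
  twoCliques with preimage a au | preimage a′ a′u
  ... | i , refl | i′ , refl = two-distinct (c i) (c i′) λ e → unrelated (sound i i′ e)
    where unrelated : R i i′ → ⊥
          unrelated (inj₁ q) = aa′ (cong h q)
          unrelated (inj₂ g) = t≢f (trans (sym g) gaa′)
  table : ∀ i j → K1Join c i j ≡ G (from i) (from j)
  table fzero fzero = trans (sym (proj₂ simp u)) (cong₂ G (sym apex) (sym apex))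
  table fzero (fsuc j) = trans (sym (universal (h j) (h≢u j))) (cong (λ q → G q (h j)) (sym apex))
  table (fsuc i) fzero = trans (sym (adj-sym (universal (h i) (h≢u i)))) (cong (G (h i)) (sym apex))
  table (fsuc i) (fsuc j) with i F.≟ j
  ... | yes refl = sym (proj₂ simp (h i))
  ... | no ne with c i F.≟ c j
  ... | yes e = sym (adjacent (sound i j e))
    where adjacent : R i j → G (h i) (h j) ≡ true
          adjacent (inj₁ q) = ⊥-elim (ne q)
          adjacent (inj₂ g) = g
  ... | no ne′ = sym (≢true⇒false λ g → ne′ (complete i j (inj₂ g)))

KminusE-loop : ∀ {m} (i : Fin (suc (suc m))) → KminusE m i i ≡ false
KminusE-loop i rewrite Equivalence.to T-≡ (≡⇒≡ᵇ (toℕ i) (toℕ i) refl) = refl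

KminusE-edge : ∀ {m} (i j : Fin (suc (suc m))) → i ≢ j →
  ¬ (i ≡ fzero × j ≡ fsuc fzero) → ¬ (i ≡ fsuc fzero × j ≡ fzero) → KminusE m i j ≡ true
KminusE-edge fzero fzero ne _ _ = ⊥-elim (ne refl)
KminusE-edge fzero (fsuc fzero) _ n01 _ = ⊥-elim (n01 (refl , refl))
KminusE-edge fzero (fsuc (fsuc j)) _ _ _ = refl
KminusE-edge (fsuc fzero) fzero _ _ n10 = ⊥-elim (n10 (refl , refl))
KminusE-edge (fsuc fzero) (fsuc fzero) ne _ _ = ⊥-elim (ne refl)
KminusE-edge (fsuc fzero) (fsuc (fsuc j)) _ _ _ = refl
KminusE-edge (fsuc (fsuc i)) fzero _ _ _ = refl
KminusE-edge (fsuc (fsuc i)) (fsuc fzero) _ _ _ = refl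
KminusE-edge (fsuc (fsuc i)) (fsuc (fsuc j)) ne _ _ with toℕ i ≡ᵇ toℕ j in e
... | true = ⊥-elim (ne (cong (fsuc ∘ fsuc) (FP.toℕ-injective (≡ᵇ-true⇒≡ _ _ e))))
... | false = refl

-- A graph whose only non-adjacent pair of distinct vertices is {a, a′} is Kₙ - e:
-- relabel a as 0 and a′ as 1.
recogniseKminusE : ∀ {n} (G : Graph n) (simp : IsSimple G) (a a′ : Fin n) → a ≢ a′ → G a a′ ≡ false →
  (∀ x y → x ≢ y → G x y ≡ false → Pair x y a a′) → ∃[ m ] (G ≅ KminusE m)
recogniseKminusE {suc zero} G simp fzero fzero aa′ _ _ = ⊥-elim (aa′ refl)
recogniseKminusE {suc (suc m)} G simp a a′ aa′ gaa′ onlyNonEdge = m , ≅-byInverse π table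
  where
  open Distance G simp
  t₁ = transpose a fzero
  b′ = Inverse.to t₁ a′
  π = t₁ ∘ₚ transpose b′ (fsuc fzero)
  open Bijection π
  b′≢0 : b′ ≢ fzero
  b′≢0 e = aa′ (sym (Bijection.to-inj t₁ (trans e (sym (transpose-matchˡ a fzero)))))
  from0 : from fzero ≡ a
  from0 = trans (cong from (sym (trans (cong (PC.transpose b′ (fsuc fzero)) (transpose-matchˡ a fzero))
                                        (transpose-other b′ (fsuc fzero) fzero (≢-sym b′≢0) λ ()))))
                (from-to a)
  from1 : from (fsuc fzero) ≡ a′
  from1 = trans (cong from (sym (transpose-matchˡ b′ (fsuc fzero)))) (from-to a′)
  tableByCases : ∀ i j → Dec (i ≡ j) → Dec (i ≡ fzero × j ≡ fsuc fzero) → Dec (i ≡ fsuc fzero × j ≡ fzero) →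
    KminusE m i j ≡ G (from i) (from j)
  tableByCases i j (yes refl) _ _ = trans (KminusE-loop i) (sym (proj₂ simp (from i)))
  tableByCases i j (no _) (yes (refl , refl)) _ = sym (subst₂ (λ x y → G x y ≡ false) (sym from0) (sym from1) gaa′)
  tableByCases i j (no _) (no _) (yes (refl , refl)) = sym (subst₂ (λ x y → G x y ≡ false) (sym from1) (sym from0) (nadj-sym gaa′))
  tableByCases i j (no ne) (no n01) (no n10) =
    trans (KminusE-edge i j ne n01 n10) (sym (≢false⇒true λ g → notEnds (onlyNonEdge (from i) (from j) (ne ∘ from-inj) g)))
    where
    notEnds : Pair (from i) (from j) a a′ → ⊥
    notEnds (inj₁ (e₁ , e₂)) = n01 (from-inj (trans e₁ (sym from0)) , from-inj (trans e₂ (sym from1)))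
    notEnds (inj₂ (e₁ , e₂)) = n10 (from-inj (trans e₁ (sym from1)) , from-inj (trans e₂ (sym from0)))
  table : ∀ i j → KminusE m i j ≡ G (from i) (from j)
  table i j = tableByCases i j (i F.≟ j) ((i F.≟ fzero) ×-dec (j F.≟ fsuc fzero)) ((i F.≟ fsuc fzero) ×-dec (j F.≟ fzero))

label4 : ∀ {n} → Fin n → Fin n → Fin n → Fin n → Fin 4 → Fin n
label4 a b a′ b′ fzero = a
label4 a b a′ b′ (fsuc fzero) = b
label4 a b a′ b′ (fsuc (fsuc fzero)) = a′
label4 a b a′ b′ (fsuc (fsuc (fsuc fzero))) = b′

label4↔ : ∀ {n} (a b a′ b′ : Fin n) → a ≢ a′ → a ≢ b → a ≢ b′ → a′ ≢ b → a′ ≢ b′ → b ≢ b′ →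
  (∀ x → x ≡ a ⊎ x ≡ b ⊎ x ≡ a′ ⊎ x ≡ b′) →
  Σ (Fin n ↔ Fin 4) λ π → ∀ i → Inverse.from π i ≡ label4 a b a′ b′ i
label4↔ a b a′ b′ aa′ ab ab′ a′b a′b′ bb′ cover = mk↔ₛ′ to label to-label label-to , λ _ → refl
  where
  label = label4 a b a′ b′
  toByCases : ∀ {x} → Dec (x ≡ a) → Dec (x ≡ b) → Dec (x ≡ a′) → Fin 4
  toByCases (yes _) _ _ = fzero
  toByCases (no _) (yes _) _ = fsuc fzero
  toByCases (no _) (no _) (yes _) = fsuc (fsuc fzero)
  toByCases (no _) (no _) (no _) = fsuc (fsuc (fsuc fzero))
  to : _ → Fin 4
  to x = toByCases (x F.≟ a) (x F.≟ b) (x F.≟ a′)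
  label-toByCases : ∀ x (d₁ : Dec (x ≡ a)) d₂ d₃ → label (toByCases d₁ d₂ d₃) ≡ x
  label-toByCases x (yes e) _ _ = sym e
  label-toByCases x (no _) (yes e) _ = sym e
  label-toByCases x (no _) (no _) (yes e) = sym e
  label-toByCases x (no n₁) (no n₂) (no n₃) with cover x
  ... | inj₁ e = ⊥-elim (n₁ e)
  ... | inj₂ (inj₁ e) = ⊥-elim (n₂ e)
  ... | inj₂ (inj₂ (inj₁ e)) = ⊥-elim (n₃ e)
  ... | inj₂ (inj₂ (inj₂ e)) = sym e
  label-to : ∀ x → label (to x) ≡ x
  label-to x = label-toByCases x (x F.≟ a) (x F.≟ b) (x F.≟ a′)
  to-label : ∀ i → to (label i) ≡ i
  to-label fzero with a F.≟ a
  ... | yes _ = refl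
  ... | no q = ⊥-elim (q refl)
  to-label (fsuc fzero) with b F.≟ a | b F.≟ b
  ... | yes e | _ = ⊥-elim (ab (sym e))
  ... | no _ | yes _ = refl
  ... | no _ | no q = ⊥-elim (q refl)
  to-label (fsuc (fsuc fzero)) with a′ F.≟ a | a′ F.≟ b | a′ F.≟ a′
  ... | yes e | _ | _ = ⊥-elim (aa′ (sym e))
  ... | no _ | yes e | _ = ⊥-elim (a′b e)
  ... | no _ | no _ | yes _ = refl
  ... | no _ | no _ | no q = ⊥-elim (q refl)
  to-label (fsuc (fsuc (fsuc fzero))) with b′ F.≟ a | b′ F.≟ b | b′ F.≟ a′
  ... | yes e | _ | _ = ⊥-elim (ab′ (sym e))
  ... | no _ | yes e | _ = ⊥-elim (bb′ (sym e))
  ... | no _ | no _ | yes e = ⊥-elim (a′b′ (sym e))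
  ... | no _ | no _ | no _ = refl

recogniseC4 : ∀ {n} (G : Graph n) (simp : IsSimple G) (a b a′ b′ : Fin n) →
  a ≢ a′ → a ≢ b → a ≢ b′ → a′ ≢ b → a′ ≢ b′ → b ≢ b′ →
  (∀ x → x ≡ a ⊎ x ≡ b ⊎ x ≡ a′ ⊎ x ≡ b′) →
  G a a′ ≡ false → G b b′ ≡ false → G a b ≡ true → G a b′ ≡ true → G a′ b ≡ true → G a′ b′ ≡ true →
  G ≅ C4
recogniseC4 G simp a b a′ b′ aa′ ab ab′ a′b a′b′ bb′ cover gaa′ gbb′ gab gab′ ga′b ga′b′ =
  ≅-byInverse π λ i j → trans (table i j) (sym (cong₂ G (fromπ i) (fromπ j)))
  where
  open Distance G simp
  π = proj₁ (label4↔ a b a′ b′ aa′ ab ab′ a′b a′b′ bb′ cover)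
  fromπ = proj₂ (label4↔ a b a′ b′ aa′ ab ab′ a′b a′b′ bb′ cover)
  label = label4 a b a′ b′
  loop : ∀ x → false ≡ G x x
  loop x = sym (proj₂ simp x)
  table : ∀ i j → C4 i j ≡ G (label i) (label j)
  table fzero fzero = loop a
  table fzero (fsuc fzero) = sym gab
  table fzero (fsuc (fsuc fzero)) = sym gaa′
  table fzero (fsuc (fsuc (fsuc fzero))) = sym gab′
  table (fsuc fzero) fzero = sym (adj-sym gab)
  table (fsuc fzero) (fsuc fzero) = loop b
  table (fsuc fzero) (fsuc (fsuc fzero)) = sym (adj-sym ga′b)
  table (fsuc fzero) (fsuc (fsuc (fsuc fzero))) = sym gbb′
  table (fsuc (fsuc fzero)) fzero = sym (nadj-sym gaa′)
  table (fsuc (fsuc fzero)) (fsuc fzero) = sym ga′b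
  table (fsuc (fsuc fzero)) (fsuc (fsuc fzero)) = loop a′
  table (fsuc (fsuc fzero)) (fsuc (fsuc (fsuc fzero))) = sym ga′b′
  table (fsuc (fsuc (fsuc fzero))) fzero = sym (adj-sym gab′)
  table (fsuc (fsuc (fsuc fzero))) (fsuc fzero) = sym (nadj-sym gbb′)
  table (fsuc (fsuc (fsuc fzero))) (fsuc (fsuc fzero)) = sym (adj-sym ga′b′)
  table (fsuc (fsuc (fsuc fzero))) (fsuc (fsuc (fsuc fzero))) = loop b′

-- If some vertex x lies at distance ≥ 3 from w, there is a mergeable triple: on a path from
-- w to x take the first edge v v′ leaving the ball of radius 2 around w, and a common neighbour
-- z of w and v; then v and z lie between v′ and w, and z lies between v and w.
module DiameterThree {n} (G : Graph n) (simp : IsSimple G) (w : Fin n) where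
  open Reach G
  open Distance G simp

  ballExit : ∀ {s t k} → Walk G s t k → reach G 2 w s ≡ true → reach G 2 w t ≡ false →
    ∃ λ v → ∃ λ v′ → G v v′ ≡ true × reach G 2 w v ≡ true × reach G 2 w v′ ≡ false
  ballExit here rs rt = ⊥-elim (t≢f (trans (sym rs) rt))
  ballExit {s} (step {y = y} g rest) rs rt with reach G 2 w y in e
  ... | true = ballExit rest e rt
  ... | false = s , y , g , rs , e

  within2 : ∀ j x → j < 3 → reach G j w x ≡ true → reach G 2 w x ≡ true
  within2 zero x _ r = reach-mono 1 w x (reach-mono 0 w x r)
  within2 (suc zero) x _ r = reach-mono 1 w x r
  within2 (suc (suc zero)) x _ r = r
  within2 (suc (suc (suc j))) x (s≤s (s≤s (s≤s ()))) r

  far⇒SRP : ∀ x → reach G 2 w x ≡ false → Connected G → HasSRP G (n ∸ 2)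
  far⇒SRP x rx conn with ballExit (proj₂ (conn w x)) (reach-refl 2 w) rx
  ... | v , v′ , vv′ , rv , rv′ =
    mergeTriple G simp v′ v z w w w v′v v′z vz w≢v′ w≢v w≢z w≢v′ w≢v w≢z w≢v′ w≢v w≢z
      v′-v-w v′-z-w v-z-w
    where
    notWithin1 : reach G 1 w v ≡ false
    notWithin1 = ≢true⇒false λ r → t≢f (trans (sym (reach-snoc 1 w v v′ r vv′)) rv′)
    wv : G w v ≡ false
    wv = ≢true⇒false λ q → t≢f (trans (sym (reach1← w v q)) notWithin1)
    w≢v : w ≢ v
    w≢v e = t≢f (trans (sym (subst (λ q → reach G 1 w q ≡ true) e (reach-refl 1 w))) notWithin1)
    middle : ∃ λ z → G w z ≡ true × G z v ≡ true
    middle with reach2→ w v rv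
    ... | inj₁ e = ⊥-elim (w≢v e)
    ... | inj₂ (inj₁ q) = ⊥-elim (t≢f (trans (sym q) wv))
    ... | inj₂ (inj₂ c) = c
    z = proj₁ middle
    wz = proj₁ (proj₂ middle)
    zv = proj₂ (proj₂ middle)
    v′z : v′ ≢ z
    v′z e = t≢f (trans (sym (reach-mono 1 w v′ (reach1← w v′ (subst (λ q → G w q ≡ true) (sym e) wz)))) rv′)
    v′≁z : G v′ z ≡ false
    v′≁z = ≢true⇒false λ q → t≢f (trans (sym (reach2← w z v′ wz (adj-sym q))) rv′)
    w≢v′ : w ≢ v′
    w≢v′ e = t≢f (trans (sym (subst (λ q → reach G 2 w q ≡ true) e (reach-refl 2 w))) rv′)
    w≢z : w ≢ z
    w≢z = adj≢ wz
    vz : v ≢ z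
    vz e = adj≢ zv (sym e)
    v′v : v′ ≢ v
    v′v = adj≢ (adj-sym vv′)
    dist-v′w : dist G v′ w ≡ 3
    dist-v′w = dist-exact 3 v′ w (three-distinct v′ v w v′v (≢-sym w≢v′) (≢-sym w≢v))
      (reach-sym 3 w v′ (reach-snoc 2 w v v′ rv vv′))
      (λ j lt → ≢true⇒false λ r → t≢f (trans (sym (within2 j v′ lt (reach-sym j v′ w r))) rv′))
    dist-vw : dist G v w ≡ 2
    dist-vw = dist2 v z w (≢-sym w≢v) (nadj-sym wv) (adj-sym zv) (adj-sym wz)
    v′-v-w : Between G simp v′ v w
    v′-v-w rewrite dist-v′w | dist1 v′ v (adj-sym vv′) | dist-vw = refl
    v′-z-w : Between G simp v′ z w
    v′-z-w rewrite dist-v′w | dist2 v′ v z v′z v′≁z (adj-sym vv′) (adj-sym zv) | dist1 z w (adj-sym wz) = refl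
    v-z-w : Between G simp v z w
    v-z-w rewrite dist-vw | dist1 v z (adj-sym zv) | dist1 z w (adj-sym wz) = refl

Family : ∀ {n} → Graph n → Set
Family G = (G ≅ P3) ⊎ (G ≅ C4) ⊎ (∃[ m ] (G ≅ KminusE m))
  ⊎ (∃[ m ] ∃[ r ] Σ (Fin m → Fin r) λ c → Surjective _≡_ _≡_ c × 2 ≤ r × (G ≅ K1Join c))

-- Structure of a graph of diameter ≤ 2 admitting no strong resolving partition with n - 2
-- classes: each configuration yielding such a partition (two disjoint mergeable pairs, or a
-- mergeable triple) is excluded.
module Structure {n} (G : Graph n) (simp : IsSimple G) (diam2 : ∀ u v → reach G 2 u v ≡ true)
  (noN2 : ¬ HasSRP G (n ∸ 2)) where
  open Reach G
  open Distance G simp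
  open Resolving G simp
  open DiameterTwo G simp diam2

  Universal : Fin n → Set
  Universal u = ∀ v → v ≢ u → G u v ≡ true

  universal? : ∀ u → Dec (Universal u)
  universal? u = FP.all? (λ v → ¬? (v F.≟ u) →-dec (G u v Data.Bool.≟ true))

  nonNeighbour : ∀ u → ¬ Universal u → ∃ λ t → t ≢ u × G u t ≡ false
  nonNeighbour u h with FP.¬∀⟶∃¬ n _ (λ v → ¬? (v F.≟ u) →-dec (G u v Data.Bool.≟ true)) h
  ... | t , ht = t , (λ e → ht (λ ne → ⊥-elim (ne e))) , ≢true⇒false (λ g → ht (λ _ → g))

  commonNeighbour : ∀ x y → x ≢ y → G x y ≡ false → ∃ λ z → G x z ≡ true × G z y ≡ true
  commonNeighbour x y ne g with reach2→ x y (diam2 x y)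
  ... | inj₁ e = ⊥-elim (ne e)
  ... | inj₂ (inj₁ q) = ⊥-elim (t≢f (trans (sym q) g))
  ... | inj₂ (inj₂ c) = c

  nonEdge-≢universal : ∀ w → Universal w → ∀ s t → s ≢ t → G s t ≡ false → s ≢ w
  nonEdge-≢universal w universal s t st g refl = t≢f (trans (sym (universal t (≢-sym st))) g)

  complete⇒noSRP : (∀ a a′ → a ≢ a′ → G a a′ ≡ true) → ∀ k → k < n → ¬ HasSRP G k
  complete⇒noSRP complete k k<n (p , srp) with FP.pigeonhole k<n p
  ... | i , j , i<j , e with orientedPair p srp i j (FP.<⇒≢ i<j) e
  ... | s , t , c , _ , _ , ps , (_ , far , v , pv , _) , _ =
        t≢f (trans (sym (complete s v (λ q → ps (trans (cong p q) pv)))) (far v pv))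

  -- No universal vertex: every vertex has exactly one non-neighbour, and G ≅ C₄.
  module NoUniversal (noUniversal : ∀ u → ¬ Universal u) where
    Detour : Fin n → Fin n → Fin n → Set
    Detour w x y = x ≢ w × G w x ≡ false × G w y ≡ true × G x y ≡ true

    -- Two detours from w with distinct ends and distinct middles merge into n - 2 classes.
    twoDetours : ∀ w x y x′ y′ → Detour w x y → Detour w x′ y′ → x ≢ x′ → y ≢ y′ → ⊥
    twoDetours w x y x′ y′ (xw , wx , wy , xy) (x′w , wx′ , wy′ , x′y′) xx′ yy′ =
      noN2 (mergeTwoPairs G simp x y x′ y′ w w (adj≢ xy) xx′ (separates (G w) wy′ wx ∘ sym)
        (separates (G w) wy wx′) yy′ (adj≢ x′y′)
        (≢-sym xw) (adj≢ wy) (≢-sym x′w) (adj≢ wy′) (≢-sym xw) (adj≢ wy) (≢-sym x′w) (adj≢ wy′)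
        (inducedPath⇒Between x y w xy (adj-sym wy) (nadj-sym wx) xw)
        (inducedPath⇒Between x′ y′ w x′y′ (adj-sym wy′) (nadj-sym wx′) x′w))

    -- A detour to x₀ through y₀ can be complemented by one through another middle vertex,
    -- built from a non-neighbour t₀ of y₀.
    secondDetour : ∀ w x₀ y₀ → Detour w x₀ y₀ → ∃ λ x₁ → ∃ λ y₁ → Detour w x₁ y₁ × y₁ ≢ y₀
    secondDetour w x₀ y₀ (x₀w , wx₀ , wy₀ , x₀y₀) with nonNeighbour y₀ (noUniversal y₀)
    ... | t₀ , t₀y₀ , y₀t₀ with G w t₀ in wt₀
    ... | false with commonNeighbour w t₀ (separates (G y₀) (adj-sym wy₀) y₀t₀) wt₀
    ...   | y′ , wy′ , y′t₀ = t₀ , y′ , (separates (G y₀) (adj-sym wy₀) y₀t₀ ∘ sym , wt₀ , wy′ , adj-sym y′t₀) ,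
                             λ q → t≢f (trans (sym y′t₀) (trans (cong (λ r → G r t₀) q) y₀t₀))
    secondDetour w x₀ y₀ (x₀w , wx₀ , wy₀ , x₀y₀) | t₀ , t₀y₀ , y₀t₀ | true with G t₀ x₀ in t₀x₀
    ... | true = x₀ , t₀ , (x₀w , wx₀ , wt₀ , adj-sym t₀x₀) , t₀y₀
    ... | false with commonNeighbour t₀ x₀ (separates (G w) wt₀ wx₀) t₀x₀
    ...   | z , t₀z , zx₀ with G w z in wz
    ...     | true = x₀ , z , (x₀w , wx₀ , wz , adj-sym zx₀) ,
                     λ q → t≢f (trans (sym (adj-sym t₀z)) (trans (cong (λ r → G r t₀) q) y₀t₀))
    ...     | false = z , t₀ , (separates (λ r → G r x₀) zx₀ wx₀ , wz , wt₀ , adj-sym t₀z) , t₀y₀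

    onlyNonNeighbour : ∀ w x₀ y₀ y₁ → Detour w x₀ y₀ → Detour w x₀ y₁ → y₁ ≢ y₀ →
      ∀ x → x ≢ w → G w x ≡ false → x ≡ x₀
    onlyNonNeighbour w x₀ y₀ y₁ d₀ d₁ y₁y₀ x xw wx with x F.≟ x₀
    ... | yes e = e
    ... | no xx₀ with commonNeighbour w x (≢-sym xw) wx
    ... | y , wy , yx with y F.≟ y₀
    ... | no yy₀ = ⊥-elim (twoDetours w x₀ y₀ x y d₀ (xw , wx , wy , adj-sym yx) (≢-sym xx₀) (≢-sym yy₀))
    ... | yes refl = ⊥-elim (twoDetours w x₀ y₁ x y d₁ (xw , wx , wy , adj-sym yx) (≢-sym xx₀) y₁y₀)

    uniqueNonNeighbour : ∀ w x₀ x → x₀ ≢ w → G w x₀ ≡ false → x ≢ w → G w x ≡ false → x ≡ x₀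
    uniqueNonNeighbour w x₀ x x₀w wx₀ = onlyNonNeighbour w x₀ y₀ y₁ d₀ d₁ y₁y₀ x
      where
      first = commonNeighbour w x₀ (≢-sym x₀w) wx₀
      y₀ = proj₁ first
      d₀ : Detour w x₀ y₀
      d₀ = x₀w , wx₀ , proj₁ (proj₂ first) , adj-sym (proj₂ (proj₂ first))
      second = secondDetour w x₀ y₀ d₀
      x₁ = proj₁ second
      y₁ = proj₁ (proj₂ second)
      y₁y₀ = proj₂ (proj₂ (proj₂ second))
      d₁ : Detour w x₀ y₁
      d₁ with x₁ F.≟ x₀
      ... | yes e = subst (λ q → Detour w q y₁) e (proj₁ (proj₂ (proj₂ second)))
      ... | no ne = ⊥-elim (twoDetours w x₀ y₀ x₁ y₁ d₀ (proj₁ (proj₂ (proj₂ second))) (≢-sym ne) (≢-sym y₁y₀))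

    adjacentUnlessPartner : ∀ u ū x → ū ≢ u → G u ū ≡ false → x ≢ u → x ≢ ū → G u x ≡ true
    adjacentUnlessPartner u ū x ūu uū xu xū = ≢false⇒true λ ux → xū (uniqueNonNeighbour u ū x ūu uū xu ux)

    -- The non-edge a a′, a common neighbour b and its partner b′ form a square covering G:
    -- a fifth vertex e and its partner ē would give two mergeable pairs {a, e} and {b, ē}.
    module Square (a a′ : Fin n) (aa′ : a ≢ a′) (gaa′ : G a a′ ≡ false) where
      b = proj₁ (commonNeighbour a a′ aa′ gaa′)
      ab = proj₁ (proj₂ (commonNeighbour a a′ aa′ gaa′))
      ba′ = proj₂ (proj₂ (commonNeighbour a a′ aa′ gaa′))
      b′ = proj₁ (nonNeighbour b (noUniversal b))
      b′b = proj₁ (proj₂ (nonNeighbour b (noUniversal b)))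
      bb′ = proj₂ (proj₂ (nonNeighbour b (noUniversal b)))
      b′a : b′ ≢ a
      b′a e = separates (G b) (adj-sym ab) bb′ (sym e)
      b′a′ : b′ ≢ a′
      b′a′ e = separates (G b) ba′ bb′ (sym e)

      noFifthVertex : ∀ e → e ≢ a → e ≢ b → e ≢ a′ → e ≢ b′ → ⊥
      noFifthVertex e ea eb ea′ eb′ =
        noN2 (mergeTwoPairs G simp a e b ē a′ b′
          (≢-sym ea) (adj≢ ab) (≢-sym ēa) eb (≢-sym ēe) (≢-sym ēb)
          (≢-sym aa′) (≢-sym ea′) (≢-sym (adj≢ ba′)) (≢-sym ēa′) b′a (≢-sym eb′) b′b (≢-sym ēb′)
          (inducedPath⇒Between a e a′ (adjacentUnlessPartner a a′ e (≢-sym aa′) gaa′ ea ea′)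
            (adj-sym (adjacentUnlessPartner a′ a e aa′ (nadj-sym gaa′) ea′ ea)) gaa′ aa′)
          (inducedPath⇒Between b ē b′ (adjacentUnlessPartner b b′ ē b′b bb′ ēb ēb′)
            (adj-sym (adjacentUnlessPartner b′ b ē (≢-sym b′b) (nadj-sym bb′) ēb′ ēb)) bb′ (≢-sym b′b)))
        where
        ē = proj₁ (nonNeighbour e (noUniversal e))
        ēe = proj₁ (proj₂ (nonNeighbour e (noUniversal e)))
        eē = proj₂ (proj₂ (nonNeighbour e (noUniversal e)))
        -- e is a non-neighbour of ē, so ē can only be a vertex whose partner is e.
        partnerOf : ∀ v v̄ → v̄ ≢ v → G v v̄ ≡ false → e ≢ v → e ≢ v̄ → ē ≢ v
        partnerOf v v̄ v̄v vv̄ ev ev̄ q =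
          ev̄ (uniqueNonNeighbour v v̄ e v̄v vv̄ ev (nadj-sym (subst (λ r → G e r ≡ false) q eē)))
        ēa = partnerOf a a′ (≢-sym aa′) gaa′ ea ea′
        ēa′ = partnerOf a′ a aa′ (nadj-sym gaa′) ea′ ea
        ēb = partnerOf b b′ b′b bb′ eb eb′
        ēb′ = partnerOf b′ b (≢-sym b′b) (nadj-sym bb′) eb′ eb

      cover : ∀ x → x ≡ a ⊎ x ≡ b ⊎ x ≡ a′ ⊎ x ≡ b′
      cover x with x F.≟ a | x F.≟ b | x F.≟ a′ | x F.≟ b′
      ... | yes e | _ | _ | _ = inj₁ e
      ... | no _ | yes e | _ | _ = inj₂ (inj₁ e)
      ... | no _ | no _ | yes e | _ = inj₂ (inj₂ (inj₁ e))
      ... | no _ | no _ | no _ | yes e = inj₂ (inj₂ (inj₂ e))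
      ... | no xa | no xb | no xa′ | no xb′ = ⊥-elim (noFifthVertex x xa xb xa′ xb′)

      isC4 : G ≅ C4
      isC4 = recogniseC4 G simp a b a′ b′ aa′ (adj≢ ab) (≢-sym b′a) (≢-sym (adj≢ ba′)) (≢-sym b′a′) (≢-sym b′b)
        cover gaa′ bb′ ab (adjacentUnlessPartner a a′ b′ (≢-sym aa′) gaa′ b′a b′a′) (adj-sym ba′)
        (adjacentUnlessPartner a′ a b′ aa′ (nadj-sym gaa′) b′a′ b′a)

  -- Two universal vertices u, c: every vertex has at most one non-neighbour, and a non-edge
  -- disjoint from a given non-edge a a′ is impossible; so G ≅ Kₙ - e.
  module TwoUniversal (u c : Fin n) (uUniversal : Universal u) (cUniversal : Universal c) (cu : c ≢ u)
    (a a′ : Fin n) (aa′ : a ≢ a′) (gaa′ : G a a′ ≡ false) where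
    -- s with non-neighbours t, t′: merge {t, u} and {t′, c}, both resolved by s.
    twoNonNeighbours : ∀ s t t′ → t ≢ t′ → t ≢ s → t′ ≢ s → G s t ≡ false → G s t′ ≡ false → ⊥
    twoNonNeighbours s t t′ tt′ ts t′s st st′ = noN2 (mergeTwoPairs G simp t u t′ c s s
      tu tt′ tc (≢-sym t′u) (≢-sym cu) t′c
      (≢-sym ts) su (≢-sym t′s) sc (≢-sym ts) su (≢-sym t′s) sc
      (inducedPath⇒Between t u s (adj-sym (uUniversal t tu)) (uUniversal s su) (nadj-sym st) ts)
      (inducedPath⇒Between t′ c s (adj-sym (cUniversal t′ t′c)) (cUniversal s sc) (nadj-sym st′) t′s))
      where
      tu = nonEdge-≢universal u uUniversal t s ts (nadj-sym st)
      tc = nonEdge-≢universal c cUniversal t s ts (nadj-sym st)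
      t′u = nonEdge-≢universal u uUniversal t′ s t′s (nadj-sym st′)
      t′c = nonEdge-≢universal c cUniversal t′ s t′s (nadj-sym st′)
      su = nonEdge-≢universal u uUniversal s t (≢-sym ts) st
      sc = nonEdge-≢universal c cUniversal s t (≢-sym ts) st

    -- A non-edge x x′ disjoint from a a′: merge {a, a′} and {x, x′}, resolved by u and c.
    disjointNonEdge : ∀ x x′ → x ≢ x′ → G x x′ ≡ false → x ≢ a → x ≢ a′ → x′ ≢ a → x′ ≢ a′ → ⊥
    disjointNonEdge x x′ xx′ gxx′ xa xa′ x′a x′a′ = noN2 (mergeTwoPairs G simp a u x c a′ x′
      au (≢-sym xa) ac (≢-sym xu) (≢-sym cu) xc
      (≢-sym aa′) a′u (≢-sym xa′) a′c x′a x′u (≢-sym xx′) x′c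
      (inducedPath⇒Between a u a′ (adj-sym (uUniversal a au)) (uUniversal a′ a′u) gaa′ aa′)
      (inducedPath⇒Between x c x′ (adj-sym (cUniversal x xc)) (cUniversal x′ x′c) gxx′ xx′))
      where
      au = nonEdge-≢universal u uUniversal a a′ aa′ gaa′
      ac = nonEdge-≢universal c cUniversal a a′ aa′ gaa′
      a′u = nonEdge-≢universal u uUniversal a′ a (≢-sym aa′) (nadj-sym gaa′)
      a′c = nonEdge-≢universal c cUniversal a′ a (≢-sym aa′) (nadj-sym gaa′)
      xu = nonEdge-≢universal u uUniversal x x′ xx′ gxx′
      xc = nonEdge-≢universal c cUniversal x x′ xx′ gxx′
      x′u = nonEdge-≢universal u uUniversal x′ x (≢-sym xx′) (nadj-sym gxx′)
      x′c = nonEdge-≢universal c cUniversal x′ x (≢-sym xx′) (nadj-sym gxx′)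

    onlyNonEdge : ∀ x y → x ≢ y → G x y ≡ false → Pair x y a a′
    onlyNonEdge x y xy g with x F.≟ a | x F.≟ a′ | y F.≟ a | y F.≟ a′
    ... | yes refl | _ | _ | yes refl = inj₁ (refl , refl)
    ... | yes refl | _ | _ | no ya′ = ⊥-elim (twoNonNeighbours a a′ y (≢-sym ya′) (≢-sym aa′) (≢-sym xy) gaa′ g)
    ... | no _ | yes refl | yes refl | _ = inj₂ (refl , refl)
    ... | no _ | yes refl | no ya | _ = ⊥-elim (twoNonNeighbours a′ a y (≢-sym ya) aa′ (≢-sym xy) (nadj-sym gaa′) g)
    ... | no xa | no xa′ | yes refl | _ = ⊥-elim (twoNonNeighbours a a′ x (≢-sym xa′) (≢-sym aa′) xa gaa′ (nadj-sym g))
    ... | no xa | no xa′ | no _ | yes refl = ⊥-elim (twoNonNeighbours a′ a x (≢-sym xa) aa′ xa′ (nadj-sym gaa′) (nadj-sym g))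
    ... | no xa | no xa′ | no ya | no ya′ = ⊥-elim (disjointNonEdge x y xy g xa xa′ ya ya′)

    isKminusE : ∃[ m ] (G ≅ KminusE m)
    isKminusE = recogniseKminusE G simp a a′ aa′ gaa′ onlyNonEdge

  -- Exactly one universal vertex u: an induced path x - y - z avoiding u would give the
  -- mergeable triple {x, y, u}; so adjacency off u is transitive and G ≅ K₁ + ⋃ K_{nᵢ}.
  module OneUniversal (u : Fin n) (uUniversal : Universal u) (noOther : ∀ c → c ≢ u → ¬ Universal c)
    (a a′ : Fin n) (aa′ : a ≢ a′) (gaa′ : G a a′ ≡ false) where
    noInducedPath : ∀ x y z → x ≢ u → y ≢ u → z ≢ u → x ≢ z →
      G x y ≡ true → G y z ≡ true → G x z ≡ false → ⊥
    noInducedPath x y z xu yu zu xz xy yz xz̸ = noN2 (mergeTriple G simp x y u z z t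
      (adj≢ xy) xu yu (≢-sym xz) (≢-sym (adj≢ yz)) zu (≢-sym xz) (≢-sym (adj≢ yz)) zu tx ty tu
      (inducedPath⇒Between x y z xy yz xz̸ xz)
      (inducedPath⇒Between x u z (adj-sym (uUniversal x xu)) (uUniversal z zu) xz̸ xz)
      (inducedPath⇒Between y u t (adj-sym (uUniversal y yu)) (uUniversal t tu) yt (≢-sym ty)))
      where
      t = proj₁ (nonNeighbour y (noOther y yu))
      ty = proj₁ (proj₂ (nonNeighbour y (noOther y yu)))
      yt = proj₂ (proj₂ (nonNeighbour y (noOther y yu)))
      tu : t ≢ u
      tu e = separates (G y) (adj-sym (uUniversal y yu)) yt (sym e)
      tx : t ≢ x
      tx e = separates (G y) (adj-sym xy) yt (sym e)

    isK1Join : ∃[ m ] ∃[ r ] Σ (Fin m → Fin r) λ c → Surjective _≡_ _≡_ c × 2 ≤ r × (G ≅ K1Join c)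
    isK1Join = recogniseK1Join G simp u uUniversal
      (λ x y z xu yu zu xz xy yz → ≢false⇒true (noInducedPath x y z xu yu zu xz xy yz)) a a′ aa′ gaa′

  -- G is not complete, and the number of universal vertices decides its family.
  family : n ∸ 1 < n → HasSRP G (n ∸ 1) → Family G
  family n∸1<n hasN1 with FP.any? (λ a → FP.any? (λ a′ → ¬? (a F.≟ a′) ×-dec (G a a′ Data.Bool.≟ false)))
  ... | no complete =
        ⊥-elim (complete⇒noSRP (λ a a′ aa′ → ≢false⇒true λ g → complete (a , a′ , aa′ , g)) _ n∸1<n hasN1)
  ... | yes (a , a′ , aa′ , gaa′) with FP.any? universal?
  ... | no none = inj₂ (inj₁ (NoUniversal.Square.isC4 (λ u uU → none (u , uU)) a a′ aa′ gaa′))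
  ... | yes (u , uU) with FP.any? (λ c → ¬? (c F.≟ u) ×-dec universal? c)
  ... | yes (c , cu , cU) = inj₂ (inj₂ (inj₁ (TwoUniversal.isKminusE u c uU cU cu a a′ aa′ gaa′)))
  ... | no noOther =
        inj₂ (inj₂ (inj₂ (OneUniversal.isK1Join u uU (λ c cu cU → noOther (c , cu , cU)) a a′ aa′ gaa′)))

backward : ∀ {n} (G : Graph n) → IsSimple G → Connected G → Family G → PdsEq G (n ∸ 1)
backward G simp conn (inj₁ (f , iso)) = Path3.pds G simp f iso
backward G simp conn (inj₂ (inj₁ (f , iso))) = Cycle4.pds G simp f iso
backward G simp conn (inj₂ (inj₂ (inj₁ (m , f , iso)))) = CompleteMinusEdge.pds G simp conn f iso
backward G simp conn (inj₂ (inj₂ (inj₂ (m , r , c , surj , r2 , f , iso)))) = JoinOfCliques.pds G simp c surj r2 f iso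

-- Forward direction: partitions with n - 2 classes are excluded, hence diameter ≤ 2.
forward : ∀ {n} (G : Graph n) → 1 ≤ n → IsSimple G → Connected G → PdsEq G (n ∸ 1) → Family G
forward {suc zero} G _ simp conn (hasN1 , _) = ⊥-elim (Resolving.noSRP0 G simp fzero hasN1)
forward {suc (suc k)} G _ simp conn (hasN1 , fewer)
  with FP.all? (λ u → FP.all? (λ v → reach G 2 u v Data.Bool.≟ true))
... | yes diam2 = Structure.family G simp diam2 (fewer k ≤-refl) ≤-refl hasN1
... | no notDiam2 with FP.¬∀⟶∃¬ _ _ (λ u → FP.all? (λ v → reach G 2 u v Data.Bool.≟ true)) notDiam2
... | w , wFar with FP.¬∀⟶∃¬ _ _ (λ v → reach G 2 w v Data.Bool.≟ true) wFar
... | x , wx = ⊥-elim (fewer k ≤-refl (DiameterThree.far⇒SRP G simp w x (≢true⇒false wx) conn))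

theorem18 : ∀ (n : ℕ) (G : Graph n) → 1 ≤ n → IsSimple G → Connected G →
    (PdsEq G (n ∸ 1) ⇔
      ((G ≅ P3) ⊎ (G ≅ C4) ⊎ (∃[ m ] (G ≅ KminusE m))
        ⊎ (∃[ m ] ∃[ r ] Σ (Fin m → Fin r) λ c →
             Surjective _≡_ _≡_ c × 2 ≤ r × (G ≅ K1Join c))))
theorem18 n G n≥1 simp conn = mk⇔ (forward G n≥1 simp conn) (backward G simp conn)
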